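{- Let $c\geq 2$ be an integer and let $\mathcal{C}=\{1,2c\}$. Then for every positive integer $n$, $\mathcal{G}_{\mathcal{C}}(n)=s_c(n)$. In other words, the nim-sequence of \textsc{cut} with cut-set $\{1,2c\}$ is \[(0, 1)^c(2, 3)^c, 1, 4, (5, 4)^{c-1}, (3, 2)^c(4, 5)^c(6, 7)^c (+8),\] which is arithmetic-periodic with period $12c$ and saltus $8$.
   Context: For a set $\mathcal{C}$ of positive integers (the cut-set), the nim-sequence $\mathcal{G}_{\mathcal{C}}$ of the game \textsc{cut} is defined recursively on positive integers by \[\mathcal{G}_{\mathcal{C}}(n)=\operatorname{mex}\{\mathcal{G}_{\mathcal{C}}(h_0)\oplus\cdots\oplus\mathcal{G}_{\mathcal{C}}(h_d)\ :\ d\in\mathcal{C},\ h_0,\dots,h_d\geq 1 \text{ integers},\ h_0+\cdots+h_d=n\},\] where $\oplus$ is bitwise XOR (nim-sum) of nonnegative integers and $\operatorname{mex}S$ is the least nonnegative integer not in $S$ (so $\mathcal{G}_{\mathcal{C}}(1)=0$). For $c\geq 2$, define $s_c$ on positive integers as follows: write $n=12cq+m$ with $q\geq 0$ and $1\leq m\leq 12c$, and set $s_c(n)=8q+t(m)$, where $t(m)=0$ (resp. $1$) if $1\le m\le 2c$ and $m$ is odd (resp. even); $t(m)=2$ (resp. $3$) if $2c<m\le 4c$ and $m$ odd (resp. even); $t(4c+1)=1$; $t(m)=5$ (resp. $4$) if $4c+2\le m\le 6c$ and $m$ odd (resp. even); $t(m)=3$ (resp. $2$) if $6c<m\le 8c$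 and $m$ odd (resp. even); $t(m)=4$ (resp. $5$) if $8c<m\le 10c$ and $m$ odd (resp. even); $t(m)=6$ (resp. $7$) if $10c<m\le 12c$ and $m$ odd (resp. even). The notation $(a_1,\dots,a_k)^j$ means the block repeated $j$ times, and $(+8)$ means the listed first $12c$ values are repeated with $8$ added each period. -}

module Defs where

open import Data.Nat using (ℕ; zero; suc; _+_; _*_; _∸_; _≡ᵇ_; _≤ᵇ_; _<ᵇ_; NonZero)
open import Data.Nat.DivMod using (_/_; _%_)
open import Data.Bool using (Bool; true; false; if_then_else_; _∧_; _∨_; not)
open import Data.List using (List; []; _∷_; [_]; map; concatMap; foldr; length; upTo)
open import Data.Bool.ListAction using (any)

-- Bitwise XOR (nim-sum) of natural numbers, by binary digits.
-- The fuel argument (a + b) bounds the number of binary digits.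
xorFuel : ℕ → ℕ → ℕ → ℕ
xorFuel zero    _ _ = 0
xorFuel (suc f) a b = ((a % 2 + b % 2) % 2) + 2 * xorFuel f (a / 2) (b / 2)

_⊕_ : ℕ → ℕ → ℕ
a ⊕ b = xorFuel (a + b) a b

infixl 6 _⊕_

elemᵇ : ℕ → List ℕ → Bool
elemᵇ x xs = any (λ y → x ≡ᵇ y) xs

-- mex: least natural number not occurring in the list.
-- (It is always ≤ length xs, so searching 0 .. length xs suffices.)
mexFrom : ℕ → ℕ → List ℕ → ℕ
mexFrom zero    x _  = x
mexFrom (suc f) x xs = if elemᵇ x xs then mexFrom f (suc x) xs else x

mex : List ℕ → ℕ
mex xs = mexFrom (length xs) 0 xs

compositions : ℕ → ℕ → List (List ℕ)
compositions zero    zero    = [ [] ]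
compositions zero    (suc m) = []
compositions (suc k) m =
  concatMap (λ i → map (suc i ∷_) (compositions k (m ∸ suc i))) (upTo m)

CutSet : Set
CutSet = ℕ → Bool

-- The options' nim-values at heap n, given values g for smaller heaps:
-- all g(h₀) ⊕ ⋯ ⊕ g(h_d) with d ∈ C (d ≥ 1), h_i ≥ 1, h₀+⋯+h_d = n.
-- (Only d ≤ n - 1 admits such compositions.)
options : CutSet → (ℕ → ℕ) → ℕ → List ℕ
options C g n =
  concatMap (λ d → if (1 ≤ᵇ d) ∧ C d
                     then map (λ hs → foldr (λ h acc → g h ⊕ acc) 0 hs)
                              (compositions (suc d) n)
                     else [])
            (upTo n)

-- table n is a function agreeing with 𝒢_C on 1 .. n
table : CutSet → ℕ → (ℕ → ℕ)
table C zero    = λ _ → 0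
table C (suc n) = λ m → if m ≡ᵇ suc n then mex (options C g (suc n)) else g m
  where g = table C n

-- The nim-sequence 𝒢_C(n) of CUT (meaningful for n ≥ 1; 𝒢_C(1) = 0).
nimSeq : CutSet → ℕ → ℕ
nimSeq C n = table C n n

cutSet1-2c : ℕ → CutSet
cutSet1-2c c d = (d ≡ᵇ 1) ∨ (d ≡ᵇ 2 * c)

even? : ℕ → Bool
even? m = m % 2 ≡ᵇ 0

t : ℕ → ℕ → ℕ
t c m =
  if m ≤ᵇ 2 * c then (if even? m then 1 else 0)
  else if m ≤ᵇ 4 * c then (if even? m then 3 else 2)
  else if m ≡ᵇ 4 * c + 1 then 1
  else if m ≤ᵇ 6 * c then (if even? m then 4 else 5)
  else if m ≤ᵇ 8 * c then (if even? m then 2 else 3)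
  else if m ≤ᵇ 10 * c then (if even? m then 5 else 4)
  else (if even? m then 7 else 6)

-- s_c(n) = 8q + t(m) where n = 12cq + m, q ≥ 0, 1 ≤ m ≤ 12c  (for n ≥ 1).
-- The case c = 0 is junk (never used: the theorem assumes c ≥ 2).
s : ℕ → ℕ → ℕ
s zero    n = 0
s (suc k) n = 8 * q + t c (n ∸ 12 * c * q)
  where
    c = suc k
    q = (n ∸ 1) / (12 * c)

{-# OPTIONS --safe #-}
-- Write n = 12c·q + m with 1 ≤ m ≤ 12c, so that s(n) = 8q + t(m), and split m further into blocks of length 2c.
-- By the mex characterisation it suffices that s(n) is not the value of an option of n while every smaller
-- value is.  Nim-addition acts separately on the bits below and above 8, and a nim-sum never exceeds the sum, so
-- an option of value s(n) would cut the residue m into 2 or 2c + 1 residues whose t-values nim-add to t(m);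
-- tracking blocks, parities and the running nim-sum through a finite invariant shows this is impossible.
-- Conversely, each smaller value is the value of a 1-cut, or of a 2c-cut leaving one or two chosen heaps beside
-- a cancelling pair and heaps of size 1; which shape works depends only on the block of m and on a four-valued
-- class of its offset, so a finite search finds it.  Both finite facts are checked by evaluation.
module Submission where

open import Defs
open import Data.Nat using (ℕ; zero; suc; pred; _+_; _*_; _∸_; _^_; _≤_; _<_; _⊓_; z≤n; s≤s; _≡ᵇ_; _≤ᵇ_; _<ᵇ_; NonZero; >-nonZero)
open import Data.Nat.Properties
open import Data.Nat.DivMod using (_/_; _%_; +-distrib-/; m<n⇒m/n≡0; m*n/n≡m; m*n%n≡0; m<n⇒m%n≡m; m%n<n; m%n≤m; m<n*o⇒m/o<n; m≡m%n+[m/n]*n; m/n<m; m/n≤m; m%n%n≡m%n; [m+kn]%n≡m%n; [m+n]%n≡m%n; 0/n≡0)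
open import Data.Nat.Induction using (<-rec)
open import Data.Nat.Tactic.RingSolver using (solve-∀)
open import Data.Nat.ListAction using (sum)
open import Data.Nat.ListAction.Properties using (sum-++)
open import Data.Bool using (Bool; true; false; not; _∧_; _∨_; _xor_; if_then_else_; T)
open import Data.Bool.Properties using (not-involutive; not-injective; not-distribˡ-xor; xor-same; T-≡; T-∧; T-∨; ∧-zeroʳ; ∨-zeroʳ)
open import Data.Bool.ListAction using (any)
open import Data.Empty using (⊥-elim)
open import Data.Sum using (_⊎_; inj₁; inj₂)
open import Data.Product using (Σ; _×_; _,_; proj₁; proj₂)
open import Data.List using (List; []; _∷_; _++_; length; map; concatMap; foldr; upTo; replicate)
open import Data.List.Properties using (length-++; length-replicate; length-map; foldr-++)
open import Data.List.Relation.Unary.Any using (here; there; satisfied)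
open import Data.List.Relation.Unary.Any.Properties using (any⁻)
open import Data.List.Relation.Unary.All using (All; []; _∷_)
import Data.List.Relation.Unary.All as All
open import Data.List.Relation.Unary.All.Properties using (++⁺; replicate⁺)
open import Data.List.Membership.Propositional using (_∈_; _∉_; lose; find)
open import Data.List.Membership.Propositional.Properties using (∈-map⁺; ∈-map⁻; ∈-concatMap⁺; ∈-concatMap⁻; ∈-upTo⁺; ∈-upTo⁻)
open import Function.Base using (_∘_)
open import Function.Bundles using (Equivalence)
open import Relation.Nullary using (¬_)
open import Relation.Binary.Definitions using (tri<; tri≈; tri>)
open import Relation.Binary.PropositionalEquality using (_≡_; _≢_; refl; sym; trans; cong; cong₂; subst; subst₂; module ≡-Reasoning)

-- Nim-addition

[q*d+r]/d≡q : ∀ q r d .{{_ : NonZero d}} → r < d → (q * d + r) / d ≡ q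
[q*d+r]/d≡q q r d r<d = begin
  (q * d + r) / d     ≡⟨ +-distrib-/ (q * d) r (subst (λ x → x + r % d < d) (sym (m*n%n≡0 q d)) (m%n<n r d)) ⟩
  q * d / d + r / d   ≡⟨ cong₂ _+_ (m*n/n≡m q d) (m<n⇒m/n≡0 r<d) ⟩
  q + 0               ≡⟨ +-identityʳ q ⟩
  q                   ∎
  where open ≡-Reasoning

[q*d+r]%d≡r : ∀ q r d .{{_ : NonZero d}} → r < d → (q * d + r) % d ≡ r
[q*d+r]%d≡r q r d r<d = trans (cong (_% d) (+-comm (q * d) r)) (trans ([m+kn]%n≡m%n r q d) (m<n⇒m%n≡m r<d))

m≡m%2+2*[m/2] : ∀ m → m ≡ m % 2 + 2 * (m / 2)
m≡m%2+2*[m/2] m = trans (m≡m%n+[m/n]*n m 2) (cong (m % 2 +_) (*-comm (m / 2) 2))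

[b+2*m]%2≡b : ∀ b m → b < 2 → (b + 2 * m) % 2 ≡ b
[b+2*m]%2≡b b m b<2 =
  trans (cong (_% 2) (+-comm b (2 * m))) (subst (λ x → (x + b) % 2 ≡ b) (*-comm m 2) ([q*d+r]%d≡r m b 2 b<2))

[b+2*m]/2≡m : ∀ b m → b < 2 → (b + 2 * m) / 2 ≡ m
[b+2*m]/2≡m b m b<2 =
  trans (cong (_/ 2) (+-comm b (2 * m))) (subst (λ x → (x + b) / 2 ≡ m) (*-comm m 2) ([q*d+r]/d≡q m b 2 b<2))

private
  m/2+n/2≤f : ∀ m n f → m + n ≤ suc f → m / 2 + n / 2 ≤ f
  m/2+n/2≤f zero    zero    f _  = z≤n
  m/2+n/2≤f zero    (suc n) f le = ≤-pred (≤-trans (m/n<m (suc n) 2 (s≤s (s≤s z≤n))) le)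
  m/2+n/2≤f (suc m) n       f le =
    ≤-pred (≤-trans (+-mono-<-≤ (m/n<m (suc m) 2 (s≤s (s≤s z≤n))) (m/n≤m n 2)) le)

  xorFuel-0-0 : ∀ f → xorFuel f 0 0 ≡ 0
  xorFuel-0-0 zero    = refl
  xorFuel-0-0 (suc f) = cong (2 *_) (xorFuel-0-0 f)

  xorFuel-irrelevant : ∀ f g m n → m + n ≤ f → m + n ≤ g → xorFuel f m n ≡ xorFuel g m n
  xorFuel-irrelevant zero    g       zero zero _ _ = sym (xorFuel-0-0 g)
  xorFuel-irrelevant (suc f) zero    zero zero _ _ = xorFuel-0-0 (suc f)
  xorFuel-irrelevant (suc f) (suc g) m    n    le le′ =
    cong (λ x → (m % 2 + n % 2) % 2 + 2 * x)
         (xorFuel-irrelevant f g (m / 2) (n / 2) (m/2+n/2≤f m n f le) (m/2+n/2≤f m n g le′))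

⊕-unfold : ∀ m n → m ⊕ n ≡ (m % 2 + n % 2) % 2 + 2 * (m / 2 ⊕ n / 2)
⊕-unfold m n = trans (xorFuel-irrelevant (m + n) (suc (m + n)) m n ≤-refl (n≤1+n _))
  (cong (λ x → (m % 2 + n % 2) % 2 + 2 * x)
        (xorFuel-irrelevant (m + n) (m / 2 + n / 2) (m / 2) (n / 2) (+-mono-≤ (m/n≤m m 2) (m/n≤m n 2)) ≤-refl))

⊕-%2 : ∀ m n → (m ⊕ n) % 2 ≡ (m % 2 + n % 2) % 2
⊕-%2 m n = trans (cong (_% 2) (⊕-unfold m n)) ([b+2*m]%2≡b _ (m / 2 ⊕ n / 2) (m%n<n (m % 2 + n % 2) 2))

⊕-/2 : ∀ m n → (m ⊕ n) / 2 ≡ m / 2 ⊕ n / 2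
⊕-/2 m n = trans (cong (_/ 2) (⊕-unfold m n)) ([b+2*m]/2≡m _ (m / 2 ⊕ n / 2) (m%n<n (m % 2 + n % 2) 2))

⊕-lowBits : ∀ x y m n → x < 2 → y < 2 → (x + 2 * m) ⊕ (y + 2 * n) ≡ (x + y) % 2 + 2 * (m ⊕ n)
⊕-lowBits x y m n x<2 y<2 = begin
  (x + 2 * m) ⊕ (y + 2 * n)
    ≡⟨ ⊕-unfold (x + 2 * m) (y + 2 * n) ⟩
  ((x + 2 * m) % 2 + (y + 2 * n) % 2) % 2 + 2 * ((x + 2 * m) / 2 ⊕ (y + 2 * n) / 2)
    ≡⟨ cong₂ (λ u v → u % 2 + 2 * v) (cong₂ _+_ ([b+2*m]%2≡b x m x<2) ([b+2*m]%2≡b y n y<2))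
                                    (cong₂ _⊕_ ([b+2*m]/2≡m x m x<2) ([b+2*m]/2≡m y n y<2)) ⟩
  (x + y) % 2 + 2 * (m ⊕ n)
    ∎
  where open ≡-Reasoning

halving-ind : (P : ℕ → Set) → P 0 → (∀ m → P (suc m / 2) → P (suc m)) → ∀ m → P m
halving-ind P P0 step = <-rec P λ where
  zero    _  → P0
  (suc m) ih → step m (ih (m/n<m (suc m) 2 (s≤s (s≤s z≤n))))

private
  [m%2+0]%2≡m%2 : ∀ m → (m % 2 + 0) % 2 ≡ m % 2
  [m%2+0]%2≡m%2 m = trans (cong (_% 2) (+-identityʳ (m % 2))) (m%n%n≡m%n m 2)

  bit-xor-cancel : ∀ a b → a < 2 → b < 2 → (a + (a + b) % 2) % 2 ≡ b
  bit-xor-cancel 0 0 _ _ = refl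
  bit-xor-cancel 0 1 _ _ = refl
  bit-xor-cancel 1 0 _ _ = refl
  bit-xor-cancel 1 1 _ _ = refl
  bit-xor-cancel (suc (suc _)) _ (s≤s (s≤s ())) _
  bit-xor-cancel 0 (suc (suc _)) _ (s≤s (s≤s ()))
  bit-xor-cancel 1 (suc (suc _)) _ (s≤s (s≤s ()))

⊕-identityʳ : ∀ m → m ⊕ 0 ≡ m
⊕-identityʳ = halving-ind (λ m → m ⊕ 0 ≡ m) refl λ m ih → begin
  suc m ⊕ 0                              ≡⟨ ⊕-unfold (suc m) 0 ⟩
  (suc m % 2 + 0) % 2 + 2 * (suc m / 2 ⊕ 0) ≡⟨ cong₂ (λ u v → u + 2 * v) ([m%2+0]%2≡m%2 (suc m)) ih ⟩
  suc m % 2 + 2 * (suc m / 2)            ≡⟨ sym (m≡m%2+2*[m/2] (suc m)) ⟩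
  suc m                                  ∎
  where open ≡-Reasoning

⊕-identityˡ : ∀ m → 0 ⊕ m ≡ m
⊕-identityˡ = halving-ind (λ m → 0 ⊕ m ≡ m) refl λ m ih → begin
  0 ⊕ suc m                          ≡⟨ ⊕-unfold 0 (suc m) ⟩
  (suc m % 2) % 2 + 2 * (0 ⊕ suc m / 2) ≡⟨ cong₂ (λ u v → u + 2 * v) (m%n%n≡m%n (suc m) 2) ih ⟩
  suc m % 2 + 2 * (suc m / 2)        ≡⟨ sym (m≡m%2+2*[m/2] (suc m)) ⟩
  suc m                              ∎
  where open ≡-Reasoning

⊕-cancelˡ : ∀ m n → m ⊕ (m ⊕ n) ≡ n
⊕-cancelˡ = halving-ind (λ m → ∀ n → m ⊕ (m ⊕ n) ≡ n) (λ n → trans (⊕-identityˡ _) (⊕-identityˡ n)) λ m ih n →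
  let a = suc m in begin
  a ⊕ (a ⊕ n)
    ≡⟨ ⊕-unfold a (a ⊕ n) ⟩
  (a % 2 + (a ⊕ n) % 2) % 2 + 2 * (a / 2 ⊕ (a ⊕ n) / 2)
    ≡⟨ cong₂ (λ u v → (a % 2 + u) % 2 + 2 * (a / 2 ⊕ v)) (⊕-%2 a n) (⊕-/2 a n) ⟩
  (a % 2 + (a % 2 + n % 2) % 2) % 2 + 2 * (a / 2 ⊕ (a / 2 ⊕ n / 2))
    ≡⟨ cong₂ (λ u v → u + 2 * v) (bit-xor-cancel _ _ (m%n<n a 2) (m%n<n n 2)) (ih (n / 2)) ⟩
  n % 2 + 2 * (n / 2)
    ≡⟨ sym (m≡m%2+2*[m/2] n) ⟩
  n ∎
  where open ≡-Reasoning

⊕≤+ : ∀ m n → m ⊕ n ≤ m + n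
⊕≤+ = halving-ind (λ m → ∀ n → m ⊕ n ≤ m + n) (λ n → ≤-reflexive (⊕-identityˡ n)) λ m ih n →
  let a = suc m in begin
  a ⊕ n                                         ≡⟨ ⊕-unfold a n ⟩
  (a % 2 + n % 2) % 2 + 2 * (a / 2 ⊕ n / 2)     ≤⟨ +-mono-≤ (m%n≤m (a % 2 + n % 2) 2) (*-monoʳ-≤ 2 (ih (n / 2))) ⟩
  (a % 2 + n % 2) + 2 * (a / 2 + n / 2)         ≡⟨ regroup (a % 2) (n % 2) (a / 2) (n / 2) ⟩
  (a % 2 + 2 * (a / 2)) + (n % 2 + 2 * (n / 2)) ≡⟨ cong₂ _+_ (sym (m≡m%2+2*[m/2] a)) (sym (m≡m%2+2*[m/2] n)) ⟩
  a + n                                         ∎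
  where
    open ≤-Reasoning
    regroup : ∀ u v x y → (u + v) + 2 * (x + y) ≡ (u + 2 * x) + (v + 2 * y)
    regroup = solve-∀

m<2^[1+k]⇒m/2<2^k : ∀ {k} m → m < 2 ^ suc k → m / 2 < 2 ^ k
m<2^[1+k]⇒m/2<2^k {k} m lt = m<n*o⇒m/o<n (subst (m <_) (*-comm 2 (2 ^ k)) lt)

⊕-split : ∀ k m n x y → x < 2 ^ k → y < 2 ^ k → (2 ^ k * m + x) ⊕ (2 ^ k * n + y) ≡ 2 ^ k * (m ⊕ n) + (x ⊕ y)
⊕-split zero m n zero zero _ _ = trans (cong₂ _⊕_ (unit m) (unit n)) (sym (unit (m ⊕ n)))
  where
    unit : ∀ a → 1 * a + 0 ≡ a
    unit = solve-∀
⊕-split zero m n (suc x) _ (s≤s ()) _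
⊕-split zero m n zero (suc y) _ (s≤s ())
⊕-split (suc k) m n x y x< y< = begin
  (2 ^ suc k * m + x) ⊕ (2 ^ suc k * n + y)
    ≡⟨ cong₂ _⊕_ (shift m x) (shift n y) ⟩
  (x % 2 + 2 * (2 ^ k * m + x / 2)) ⊕ (y % 2 + 2 * (2 ^ k * n + y / 2))
    ≡⟨ ⊕-lowBits (x % 2) (y % 2) (2 ^ k * m + x / 2) (2 ^ k * n + y / 2) (m%n<n x 2) (m%n<n y 2) ⟩
  (x % 2 + y % 2) % 2 + 2 * ((2 ^ k * m + x / 2) ⊕ (2 ^ k * n + y / 2))
    ≡⟨ cong (λ z → (x % 2 + y % 2) % 2 + 2 * z)
            (⊕-split k m n (x / 2) (y / 2) (m<2^[1+k]⇒m/2<2^k {k} x x<) (m<2^[1+k]⇒m/2<2^k {k} y y<)) ⟩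
  (x % 2 + y % 2) % 2 + 2 * (2 ^ k * (m ⊕ n) + (x / 2 ⊕ y / 2))
    ≡⟨ reassoc ((x % 2 + y % 2) % 2) (2 ^ k) (m ⊕ n) (x / 2 ⊕ y / 2) ⟩
  2 ^ suc k * (m ⊕ n) + ((x % 2 + y % 2) % 2 + 2 * (x / 2 ⊕ y / 2))
    ≡⟨ cong (2 ^ suc k * (m ⊕ n) +_) (sym (⊕-unfold x y)) ⟩
  2 ^ suc k * (m ⊕ n) + (x ⊕ y)
    ∎
  where
    open ≡-Reasoning
    reassoc : ∀ u p a z → u + 2 * (p * a + z) ≡ 2 * p * a + (u + 2 * z)
    reassoc = solve-∀
    shift : ∀ a z → 2 ^ suc k * a + z ≡ z % 2 + 2 * (2 ^ k * a + z / 2)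
    shift a z = trans (cong (2 ^ suc k * a +_) (m≡m%2+2*[m/2] z)) (sym (reassoc (z % 2) (2 ^ k) a (z / 2)))

⊕-<-2^ : ∀ k x y → x < 2 ^ k → y < 2 ^ k → x ⊕ y < 2 ^ k
⊕-<-2^ zero    zero    zero    _  _  = s≤s z≤n
⊕-<-2^ zero    (suc _) _       (s≤s ()) _
⊕-<-2^ zero    zero    (suc _) _ (s≤s ())
⊕-<-2^ (suc k) x       y       x< y< = begin-strict
  x ⊕ y                                     ≡⟨ ⊕-unfold x y ⟩
  (x % 2 + y % 2) % 2 + 2 * (x / 2 ⊕ y / 2) <⟨ +-monoˡ-< _ (m%n<n (x % 2 + y % 2) 2) ⟩
  2 + 2 * (x / 2 ⊕ y / 2)                   ≡⟨ sym (*-suc 2 _) ⟩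
  2 * suc (x / 2 ⊕ y / 2)                   ≤⟨ *-monoʳ-≤ 2 (⊕-<-2^ k (x / 2) (y / 2)
                                                 (m<2^[1+k]⇒m/2<2^k {k} x x<) (m<2^[1+k]⇒m/2<2^k {k} y y<)) ⟩
  2 ^ suc k                                 ∎
  where open ≤-Reasoning

≡ᵇ-refl : ∀ n → (n ≡ᵇ n) ≡ true
≡ᵇ-refl n = Equivalence.to T-≡ (≡⇒≡ᵇ n n refl)

T-ext : ∀ {a b} → (T a → T b) → (T b → T a) → a ≡ b
T-ext {false} {false} _ _ = refl
T-ext {false} {true}  _ f = ⊥-elim (f _)
T-ext {true}  {false} f _ = ⊥-elim (f _)
T-ext {true}  {true}  _ _ = refl

infixr 4 _⇒ᵇ_
_⇒ᵇ_ : Bool → Bool → Bool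
a ⇒ᵇ b = not a ∨ b

⇒ᵇ-elim : ∀ {a b} → T (a ⇒ᵇ b) → T a → T b
⇒ᵇ-elim {true} ab _ = ab

T-not-elim : ∀ {b} → T (not b) → ¬ T b
T-not-elim {false} _ ()

isOdd : ℕ → Bool
isOdd zero    = false
isOdd (suc n) = not (isOdd n)

isOdd-+ : ∀ m n → isOdd (m + n) ≡ isOdd m xor isOdd n
isOdd-+ zero    n = refl
isOdd-+ (suc m) n = trans (cong not (isOdd-+ m n)) (not-distribˡ-xor (isOdd m) (isOdd n))

isOdd-2* : ∀ m → isOdd (2 * m) ≡ false
isOdd-2* m = trans (cong (λ z → isOdd (m + z)) (+-identityʳ m)) (trans (isOdd-+ m m) (xor-same (isOdd m)))

isOdd-2*+ : ∀ m n → isOdd (2 * m + n) ≡ isOdd n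
isOdd-2*+ m n = trans (isOdd-+ (2 * m) n) (cong (_xor isOdd n) (isOdd-2* m))

even?≡not-isOdd : ∀ m → even? m ≡ not (isOdd m)
even?≡not-isOdd zero          = refl
even?≡not-isOdd (suc zero)    = refl
even?≡not-isOdd (suc (suc m)) =
  trans (cong (_≡ᵇ 0) (trans (cong (_% 2) (+-comm 2 m)) ([m+n]%n≡m%n m 2)))
        (trans (even?≡not-isOdd m) (sym (cong not (not-involutive (isOdd m)))))

isOdd≡false⇒even : ∀ m → isOdd m ≡ false → Σ ℕ λ k → m ≡ 2 * k
isOdd≡false⇒even zero                _ = 0 , refl
isOdd≡false⇒even (suc zero)          ()
isOdd≡false⇒even (suc (suc m)) m-even with isOdd≡false⇒even m (trans (sym (not-involutive (isOdd m))) m-even)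
... | k , refl = suc k , sym (*-suc 2 k)

isOdd-+2* : ∀ m n → isOdd (m + 2 * n) ≡ isOdd m
isOdd-+2* m n = trans (cong isOdd (+-comm m (2 * n))) (isOdd-2*+ n m)

same-parity-gap : ∀ {m n} → m ≤ n → isOdd m ≡ isOdd n → Σ ℕ λ k → n ≡ m + 2 * k
same-parity-gap {n = n} z≤n       0≡n = isOdd≡false⇒even n (sym 0≡n)
same-parity-gap         (s≤s m≤n) m≡n with k , refl ← same-parity-gap m≤n (not-injective m≡n) = k , refl

-- Mex and options

elemᵇ≡true⇒∈ : ∀ x xs → elemᵇ x xs ≡ true → x ∈ xs
elemᵇ≡true⇒∈ x (y ∷ ys) e with x ≡ᵇ y in x≡ᵇy
... | true  = here (≡ᵇ⇒≡ x y (subst T (sym x≡ᵇy) _))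
... | false = there (elemᵇ≡true⇒∈ x ys e)

∈⇒elemᵇ≡true : ∀ {x xs} → x ∈ xs → elemᵇ x xs ≡ true
∈⇒elemᵇ≡true {x} (here refl) rewrite ≡ᵇ-refl x = refl
∈⇒elemᵇ≡true {x} {y ∷ _} (there x∈) with x ≡ᵇ y
... | true  = refl
... | false = ∈⇒elemᵇ≡true x∈

∉⇒elemᵇ≡false : ∀ {x xs} → x ∉ xs → elemᵇ x xs ≡ false
∉⇒elemᵇ≡false {x} {xs} x∉ with elemᵇ x xs in e
... | true  = ⊥-elim (x∉ (elemᵇ≡true⇒∈ x xs e))
... | false = refl

private
  remove : ∀ {v : ℕ} {xs} → v ∈ xs → List ℕ
  remove {xs = _ ∷ ys} (here _)  = ys
  remove {xs = y ∷ _}  (there p) = y ∷ remove p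

  length-remove : ∀ {v : ℕ} {xs} (p : v ∈ xs) → suc (length (remove p)) ≡ length xs
  length-remove (here _)  = refl
  length-remove (there p) = cong suc (length-remove p)

  ∈-remove : ∀ {v w : ℕ} {xs} (p : v ∈ xs) → w ∈ xs → w ≢ v → w ∈ remove p
  ∈-remove (here refl) (here refl) w≢v = ⊥-elim (w≢v refl)
  ∈-remove (here _)    (there q)   _   = q
  ∈-remove (there p)   (here refl) _   = here refl
  ∈-remove (there p)   (there q)   w≢v = there (∈-remove p q w≢v)

⊆-upTo⇒≤length : ∀ v xs → (∀ w → w < v → w ∈ xs) → v ≤ length xs
⊆-upTo⇒≤length zero    xs _    = z≤n
⊆-upTo⇒≤length (suc v) xs below = subst (suc v ≤_) (length-remove v∈)
  (s≤s (⊆-upTo⇒≤length v (remove v∈) λ w w<v → ∈-remove v∈ (below w (m<n⇒m<1+n w<v)) (<⇒≢ w<v)))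
  where v∈ = below v ≤-refl

mexFrom-unique : ∀ f x v xs → x ≤ v → v ≤ f + x → (∀ w → x ≤ w → w < v → w ∈ xs) → v ∉ xs → mexFrom f x xs ≡ v
mexFrom-unique zero    x v xs x≤v v≤x _ _ = ≤-antisym x≤v v≤x
mexFrom-unique (suc f) x v xs x≤v v≤ below v∉ with m≤n⇒m<n∨m≡n x≤v
... | inj₂ refl rewrite ∉⇒elemᵇ≡false v∉ = refl
... | inj₁ x<v rewrite ∈⇒elemᵇ≡true (below x ≤-refl x<v) =
  mexFrom-unique f (suc x) v xs x<v (subst (v ≤_) (sym (+-suc f x)) v≤) (λ w x<w → below w (<⇒≤ x<w)) v∉

mex-unique : ∀ v xs → (∀ w → w < v → w ∈ xs) → v ∉ xs → mex xs ≡ v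
mex-unique v xs below v∉ =
  mexFrom-unique (length xs) 0 v xs z≤n (subst (v ≤_) (sym (+-identityʳ _)) (⊆-upTo⇒≤length v xs below))
    (λ w _ → below w) v∉

∈-compositions⁻ : ∀ k n {hs} → hs ∈ compositions k n → length hs ≡ k × All (1 ≤_) hs × sum hs ≡ n
∈-compositions⁻ zero    zero    (here refl) = refl , [] , refl
∈-compositions⁻ (suc k) n       hs∈
  with i , i∈ , hs∈′ ← find (∈-concatMap⁻ (λ i → map (suc i ∷_) (compositions k (n ∸ suc i))) {xs = upTo n} hs∈)
  with hs′ , hs′∈ , refl ← ∈-map⁻ (suc i ∷_) hs∈′
  with len , pos , total ← ∈-compositions⁻ k (n ∸ suc i) hs′∈
  = cong suc len , s≤s z≤n ∷ pos , trans (cong (suc i +_) total) (m+[n∸m]≡n (∈-upTo⁻ i∈))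

∈-compositions⁺ : ∀ {hs} → All (1 ≤_) hs → hs ∈ compositions (length hs) (sum hs)
∈-compositions⁺ [] = here refl
∈-compositions⁺ {suc i ∷ hs} (s≤s z≤n ∷ pos) =
  ∈-concatMap⁺ (λ j → map (suc j ∷_) (compositions (length hs) (suc i + sum hs ∸ suc j)))
    (lose (∈-upTo⁺ (s≤s (m≤m+n i (sum hs))))
          (subst (λ z → suc i ∷ hs ∈ map (suc i ∷_) (compositions (length hs) z)) (sym (m+n∸m≡n (suc i) (sum hs)))
                 (∈-map⁺ (suc i ∷_) (∈-compositions⁺ pos))))

length≤sum : ∀ {hs} → All (1 ≤_) hs → length hs ≤ sum hs
length≤sum []          = z≤n
length≤sum (1≤h ∷ pos) = +-mono-≤ 1≤h (length≤sum pos)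

part+length≤1+sum : ∀ {x hs} → All (1 ≤_) hs → x ∈ hs → x + length hs ≤ suc (sum hs)
part+length≤1+sum {x} {_ ∷ hs} (_ ∷ pos) (here refl) =
  subst (_≤ suc (x + sum hs)) (sym (+-suc x (length hs))) (s≤s (+-monoʳ-≤ x (length≤sum pos)))
part+length≤1+sum {x} {h ∷ hs} (1≤h ∷ pos) (there x∈) =
  subst (_≤ suc (h + sum hs)) (sym (+-suc x (length hs)))
        (≤-trans (s≤s (part+length≤1+sum pos x∈)) (s≤s (+-monoˡ-≤ (sum hs) 1≤h)))

nimSumOf : (ℕ → ℕ) → List ℕ → ℕ
nimSumOf g hs = foldr (λ h acc → g h ⊕ acc) 0 hs

private
  cutOptions : CutSet → (ℕ → ℕ) → ℕ → ℕ → List ℕ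
  cutOptions C g n d = if (1 ≤ᵇ d) ∧ C d then map (nimSumOf g) (compositions (suc d) n) else []

∈-options⁻ : ∀ C g n {v} → v ∈ options C g n →
             Σ ℕ λ d → 1 ≤ d × C d ≡ true × Σ (List ℕ) λ hs → hs ∈ compositions (suc d) n × v ≡ nimSumOf g hs
∈-options⁻ C g n v∈
  with d , _ , v∈′ ← find (∈-concatMap⁻ (cutOptions C g n) {xs = upTo n} v∈) | 1 ≤ᵇ d in 1≤ᵇd | C d in d∈C
... | true  | true with hs , hs∈ , v≡ ← ∈-map⁻ (nimSumOf g) v∈′ =
  d , ≤ᵇ⇒≤ 1 d (subst T (sym 1≤ᵇd) _) , d∈C , hs , hs∈ , v≡
... | true  | false with () ← v∈′
... | false | _     with () ← v∈′

∈-options⁺ : ∀ C g n {d hs} → 1 ≤ d → C d ≡ true → hs ∈ compositions (suc d) n → nimSumOf g hs ∈ options C g n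
∈-options⁺ C g n {suc d} {hs} (s≤s z≤n) d∈C hs∈ with len , pos , total ← ∈-compositions⁻ (suc (suc d)) n hs∈ =
  ∈-concatMap⁺ (cutOptions C g n) {xs = upTo n}
    (lose (∈-upTo⁺ d<n) (subst (λ b → nimSumOf g hs ∈ (if b then _ else [])) (sym d∈C) (∈-map⁺ (nimSumOf g) hs∈)))
  where
    d<n : suc d < n
    d<n = subst₂ _≤_ len total (length≤sum pos)

nimSumOf-cong : ∀ {g g′} hs → (∀ {h} → h ∈ hs → g h ≡ g′ h) → nimSumOf g hs ≡ nimSumOf g′ hs
nimSumOf-cong []       _  = refl
nimSumOf-cong (h ∷ hs) eq = cong₂ _⊕_ (eq (here refl)) (nimSumOf-cong hs (eq ∘ there))

-- Every cut leaves at least two parts, so each part is smaller than n.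
options-cong : ∀ C {g g′} n → (∀ m → 1 ≤ m → m < n → g m ≡ g′ m) → ∀ {v} → v ∈ options C g n → v ∈ options C g′ n
options-cong C {g} {g′} n agree v∈ with d , 1≤d , d∈C , hs , hs∈ , refl ← ∈-options⁻ C g n v∈ =
  subst (_∈ options C g′ n) (sym (nimSumOf-cong hs agree-on-parts)) (∈-options⁺ C g′ n 1≤d d∈C hs∈)
  where
    agree-on-parts : ∀ {h} → h ∈ hs → g h ≡ g′ h
    agree-on-parts {h} h∈ with len , pos , total ← ∈-compositions⁻ (suc d) n hs∈ =
      agree h (All.lookup pos h∈) (≤-pred (begin
        2 + h         ≡⟨ +-comm 2 h ⟩
        h + 2         ≤⟨ +-monoʳ-≤ h (subst (2 ≤_) (sym len) (s≤s 1≤d)) ⟩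
        h + length hs ≤⟨ part+length≤1+sum pos h∈ ⟩
        suc (sum hs)  ≡⟨ cong suc total ⟩
        suc n         ∎))
      where open ≤-Reasoning

module _ (C : CutSet) (f : ℕ → ℕ)
         (f∉options : ∀ n → 1 ≤ n → f n ∉ options C f n)
         (<f∈options : ∀ n w → 1 ≤ n → w < f n → w ∈ options C f n) where

  private
    mex-options : ∀ n g → 1 ≤ n → (∀ m → 1 ≤ m → m < n → g m ≡ f m) → mex (options C g n) ≡ f n
    mex-options n g 1≤n agree = mex-unique (f n) (options C g n)
      (λ w w<fn → options-cong C n (λ m 1≤m m<n → sym (agree m 1≤m m<n)) (<f∈options n w 1≤n w<fn))
      (λ fn∈ → f∉options n 1≤n (options-cong C n agree fn∈))

    table-correct : ∀ n m → 1 ≤ m → m ≤ n → table C n m ≡ f m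
    table-correct zero    m 1≤m m≤0 = ⊥-elim (<⇒≱ 1≤m m≤0)
    table-correct (suc n) m 1≤m m≤ with m ≡ᵇ suc n in m≡ᵇ
    ... | true rewrite ≡ᵇ⇒≡ m (suc n) (subst T (sym m≡ᵇ) _) =
      mex-options (suc n) (table C n) (s≤s z≤n) (λ m′ 1≤m′ m′<n → table-correct n m′ 1≤m′ (≤-pred m′<n))
    ... | false = table-correct n m 1≤m (≤-pred (≤∧≢⇒< m≤ λ m≡1+n → subst T m≡ᵇ (≡⇒≡ᵇ m (suc n) m≡1+n)))

  nimSeq-characterisation : ∀ n → 1 ≤ n → nimSeq C n ≡ f n
  nimSeq-characterisation n 1≤n = table-correct n n 1≤n ≤-refl

module _ (g : ℕ → ℕ) (g1≡0 : g 1 ≡ 0) where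

  private
    sum-replicate-1 : ∀ k → sum (replicate k 1) ≡ k
    sum-replicate-1 zero    = refl
    sum-replicate-1 (suc k) = cong suc (sum-replicate-1 k)

    nimSum-ones : ∀ k → nimSumOf g (replicate k 1) ≡ 0
    nimSum-ones zero    = refl
    nimSum-ones (suc k) = cong₂ _⊕_ g1≡0 (nimSum-ones k)

    padding : ℕ → ℕ → List ℕ
    padding a k = suc a ∷ suc a ∷ replicate k 1

    nimSum-padding : ∀ ps a k → nimSumOf g (ps ++ padding a k) ≡ nimSumOf g ps
    nimSum-padding ps a k = trans (foldr-++ _ 0 ps (padding a k))
      (cong (λ z → foldr (λ h acc → g h ⊕ acc) z ps) (trans (⊕-cancelˡ (g (suc a)) _) (nimSum-ones k)))

  -- The two equal heaps cancel and the heaps of size 1 have value 0.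
  padded-option : ∀ c {n ps} a k → All (1 ≤_) ps → suc (length ps + k) ≡ 2 * c → sum ps + (2 * suc a + k) ≡ n →
                  nimSumOf g ps ∈ options (cutSet1-2c c) g n
  padded-option c {n} {ps} a k pos parts total =
    subst (_∈ options (cutSet1-2c c) g n) (nimSum-padding ps a k)
      (∈-options⁺ (cutSet1-2c c) g n 1≤2c 2c∈C
        (subst₂ (λ ℓ m → hs ∈ compositions ℓ m) len sm (∈-compositions⁺ hs-pos)))
    where
      hs = ps ++ padding a k
      hs-pos : All (1 ≤_) hs
      hs-pos = ++⁺ pos (s≤s z≤n ∷ s≤s z≤n ∷ replicate⁺ k (s≤s z≤n))
      len : length hs ≡ suc (2 * c)
      len = begin
        length (ps ++ padding a k)                     ≡⟨ length-++ ps ⟩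
        length ps + suc (suc (length (replicate k 1))) ≡⟨ cong (λ z → length ps + suc (suc z)) (length-replicate k) ⟩
        length ps + suc (suc k)                        ≡⟨ +-suc (length ps) (suc k) ⟩
        suc (length ps + suc k)                        ≡⟨ cong suc (+-suc (length ps) k) ⟩
        suc (suc (length ps + k))                      ≡⟨ cong suc parts ⟩
        suc (2 * c)                                    ∎
        where open ≡-Reasoning
      sm : sum hs ≡ n
      sm = begin
        sum (ps ++ padding a k)                          ≡⟨ sum-++ ps (padding a k) ⟩
        sum ps + (suc a + (suc a + sum (replicate k 1))) ≡⟨ cong (λ z → sum ps + (suc a + (suc a + z))) (sum-replicate-1 k) ⟩
        sum ps + (suc a + (suc a + k))                   ≡⟨ cong (sum ps +_) (twice (suc a) k) ⟩
        sum ps + (2 * suc a + k)                         ≡⟨ total ⟩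
        n                                                ∎
        where
          open ≡-Reasoning
          twice : ∀ x k → x + (x + k) ≡ 2 * x + k
          twice = solve-∀
      1≤2c : 1 ≤ 2 * c
      1≤2c = subst (1 ≤_) parts (s≤s z≤n)
      2c∈C : cutSet1-2c c (2 * c) ≡ true
      2c∈C = trans (cong ((2 * c ≡ᵇ 1) ∨_) (≡ᵇ-refl (2 * c))) (∨-zeroʳ _)

  heap-option : ∀ c {n x} → 1 ≤ c → 1 ≤ x → x + 2 * c ≤ n → isOdd x ≡ isOdd n → g x ∈ options (cutSet1-2c c) g n
  heap-option zero    ()
  heap-option (suc c) {n} {x} _ 1≤x x+2c≤n x≡n with a , refl ← same-parity-gap x+2c≤n (trans (isOdd-+2* x (suc c)) x≡n) =
    subst (_∈ options (cutSet1-2c (suc c)) g n) (⊕-identityʳ (g x))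
      (padded-option (suc c) a (2 * c) (1≤x ∷ []) (parts c) (total x a c))
    where
      parts : ∀ c → suc (1 + 2 * c) ≡ 2 * suc c
      parts = solve-∀
      total : ∀ x a c → x + 0 + (2 * suc a + 2 * c) ≡ x + 2 * suc c + 2 * a
      total = solve-∀

  twoHeap-option : ∀ c {n x y} → 2 ≤ c → 1 ≤ x → 1 ≤ y → x + y + 2 * c ≤ suc n → isOdd (x + y) ≡ not (isOdd n) →
                   g x ⊕ g y ∈ options (cutSet1-2c c) g n
  twoHeap-option zero          ()
  twoHeap-option (suc zero)    (s≤s ())
  twoHeap-option (suc (suc c)) {n} {x} {y} _ 1≤x 1≤y x+y+2c≤ x+y≢n
    with a , 1+n≡ ← same-parity-gap x+y+2c≤ (trans (isOdd-+2* (x + y) (suc (suc c))) x+y≢n) =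
    subst (_∈ options (cutSet1-2c (suc (suc c))) g n) (cong (g x ⊕_) (⊕-identityʳ (g y)))
      (padded-option (suc (suc c)) a (2 * c + 1) (1≤x ∷ 1≤y ∷ []) (parts c)
        (suc-injective (trans (total x y a c) (sym 1+n≡))))
    where
      parts : ∀ c → suc (2 + (2 * c + 1)) ≡ 2 * suc (suc c)
      parts = solve-∀
      total : ∀ x y a c → suc (x + (y + 0) + (2 * suc a + (2 * c + 1))) ≡ x + y + 2 * suc (suc c) + 2 * a
      total = solve-∀

  split-option : ∀ c {n a b} → 1 ≤ a → 1 ≤ b → a + b ≡ n → g a ⊕ g b ∈ options (cutSet1-2c c) g n
  split-option c {n} {a} {b} 1≤a 1≤b a+b≡n =
    subst (_∈ options (cutSet1-2c c) g n) (cong (g a ⊕_) (⊕-identityʳ (g b)))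
      (∈-options⁺ (cutSet1-2c c) g n {d = 1} (s≤s z≤n) refl
        (subst (λ m → a ∷ b ∷ [] ∈ compositions 2 m) (trans (cong (a +_) (+-identityʳ b)) a+b≡n)
          (∈-compositions⁺ (1≤a ∷ 1≤b ∷ []))))

-- Blocks of length d, counted from 1: the block of index J consists of d * J + 1 .. d * J + d.
1+m≡d*[m/d]+1+[m%d] : ∀ m d .{{_ : NonZero d}} → suc m ≡ d * (m / d) + suc (m % d)
1+m≡d*[m/d]+1+[m%d] m d = begin
  suc m                         ≡⟨ cong suc (m≡m%n+[m/n]*n m d) ⟩
  suc (m % d + m / d * d)       ≡⟨ cong suc (+-comm (m % d) (m / d * d)) ⟩
  suc (m / d * d + m % d)       ≡⟨ sym (+-suc (m / d * d) (m % d)) ⟩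
  m / d * d + suc (m % d)       ≡⟨ cong (_+ suc (m % d)) (*-comm (m / d) d) ⟩
  d * (m / d) + suc (m % d)     ∎
  where open ≡-Reasoning

block-< : ∀ {d J ρ i} → ρ < d → J < i → d * J + ρ < d * i
block-< {d} {J} {ρ} {i} ρ<d J<i = begin-strict
  d * J + ρ     <⟨ +-monoʳ-< (d * J) ρ<d ⟩
  d * J + d     ≡⟨ +-comm (d * J) d ⟩
  d + d * J     ≡⟨ sym (*-suc d J) ⟩
  d * suc J     ≤⟨ *-monoʳ-≤ d J<i ⟩
  d * i         ∎
  where open ≤-Reasoning

block-<⁻ : ∀ {d J ρ i} → d * J + ρ < d * i → J < i
block-<⁻ {d} {J} {ρ} {i} lt = *-cancelˡ-< d J i (≤-<-trans (m≤m+n (d * J) ρ) lt)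

block-≤⁻ : ∀ {d J ρ i} → ρ < d → d * i ≤ d * J + ρ → i ≤ J
block-≤⁻ {d} {J} {ρ} {i} ρ<d le = ≤-pred (*-cancelˡ-< d i (suc J) (≤-<-trans le (block-< ρ<d ≤-refl)))

block-injective : ∀ {d J J′ ρ ρ′} → ρ < d → ρ′ < d → d * J + ρ ≡ d * J′ + ρ′ → J ≡ J′ × ρ ≡ ρ′
block-injective {d} {J} {J′} {ρ} {ρ′} ρ<d ρ′<d eq with <-cmp J J′
... | tri< J<J′ _ _ = ⊥-elim (<⇒≱ (block-< ρ<d J<J′) (≤-trans (m≤m+n (d * J′) ρ′) (≤-reflexive (sym eq))))
... | tri> _ _ J′<J = ⊥-elim (<⇒≱ (block-< ρ′<d J′<J) (≤-trans (m≤m+n (d * J) ρ) (≤-reflexive eq)))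
... | tri≈ _ refl _ = refl , +-cancelˡ-≡ (d * J) ρ ρ′ eq

block-<-lex : ∀ {d a b x y} → y < d → d * a + x < d * b + y → a < b ⊎ (a ≡ b × x < y)
block-<-lex {d} {a} {b} {x} {y} y<d lt with <-cmp a b
... | tri< a<b _ _ = inj₁ a<b
... | tri≈ _ refl _ = inj₂ (refl , +-cancelˡ-< (d * a) x y lt)
... | tri> _ _ b<a = ⊥-elim (<-asym lt (<-≤-trans (block-< y<d b<a) (m≤m+n (d * a) x)))

block-carry : ∀ {d J ρ X R} → ρ < d → R < d + d → d * J + ρ ≡ d * X + R → (J ≡ X × ρ ≡ R) ⊎ J ≡ suc X
block-carry {d} {J} {ρ} {X} {R} ρ<d R<2d eq
  with m≤n⇒m<n∨m≡n (block-≤⁻ ρ<d (≤-trans (m≤m+n (d * X) R) (≤-reflexive (sym eq))))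
... | inj₂ refl = inj₁ (refl , +-cancelˡ-≡ (d * X) ρ R eq)
... | inj₁ X<J  = inj₂ (≤-antisym (≤-pred (block-<⁻ {d} {J} {ρ} (begin-strict
  d * J + ρ          ≡⟨ eq ⟩
  d * X + R          <⟨ +-monoʳ-< (d * X) R<2d ⟩
  d * X + (d + d)    ≡⟨ shift d X ⟩
  d * suc (suc X)    ∎))) X<J)
  where
    open ≤-Reasoning
    shift : ∀ d X → d * X + (d + d) ≡ d * suc (suc X)
    shift = solve-∀

-- t(m) for m in the block J (of length 2c), by the parity of m; the flag marks the exceptional m = 4c + 1.
tBlock : ℕ → Bool → Bool → ℕ
tBlock 0 even _     = if even then 1 else 0
tBlock 1 even _     = if even then 3 else 2
tBlock 2 even true  = 1
tBlock 2 even false = if even then 4 else 5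
tBlock 3 even _     = if even then 2 else 3
tBlock 4 even _     = if even then 5 else 4
tBlock _ even _     = if even then 7 else 6

private
  2*i*c≡2*c*i : ∀ i c → 2 * i * c ≡ 2 * c * i
  2*i*c≡2*c*i = solve-∀

  4c+1≡1+2c*2 : ∀ c → 4 * c + 1 ≡ suc (2 * c * 2 + 0)
  4c+1≡1+2c*2 = solve-∀

  ≤ᵇ-block : ∀ {c J ρ} i → ρ < 2 * c → (suc (2 * c * J + ρ) ≤ᵇ 2 * i * c) ≡ (J <ᵇ i)
  ≤ᵇ-block {c} {J} {ρ} i ρ< rewrite 2*i*c≡2*c*i i c =
    T-ext (λ le → <⇒<ᵇ (block-<⁻ {2 * c} {J} {ρ} {i} (≤ᵇ⇒≤ (suc (2 * c * J + ρ)) (2 * c * i) le)))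
          (λ lt → ≤⇒≤ᵇ (block-< ρ< (<ᵇ⇒< J i lt)))

  ≡ᵇ-block : ∀ {c J ρ} → ρ < 2 * c → (suc (2 * c * J + ρ) ≡ᵇ 4 * c + 1) ≡ (J ≡ᵇ 2) ∧ (ρ ≡ᵇ 0)
  ≡ᵇ-block {c} {J} {ρ} ρ< = T-ext forward backward
    where
      forward : T (suc (2 * c * J + ρ) ≡ᵇ 4 * c + 1) → T ((J ≡ᵇ 2) ∧ (ρ ≡ᵇ 0))
      forward eq
        with refl , refl ← block-injective ρ< (≤-trans (s≤s z≤n) ρ<) (suc-injective (trans (≡ᵇ⇒≡ _ _ eq) (4c+1≡1+2c*2 c))) = _
      backward : T ((J ≡ᵇ 2) ∧ (ρ ≡ᵇ 0)) → T (suc (2 * c * J + ρ) ≡ᵇ 4 * c + 1)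
      backward t with J≡2 , ρ≡0 ← Equivalence.to T-∧ t rewrite ≡ᵇ⇒≡ J 2 J≡2 | ≡ᵇ⇒≡ ρ 0 ρ≡0 =
        ≡⇒≡ᵇ _ _ (sym (4c+1≡1+2c*2 c))

  tBlock-tests : ∀ J even z → J < 6 →
    (if J <ᵇ 1 then (if even then 1 else 0)
     else if J <ᵇ 2 then (if even then 3 else 2)
     else if (J ≡ᵇ 2) ∧ z then 1
     else if J <ᵇ 3 then (if even then 4 else 5)
     else if J <ᵇ 4 then (if even then 2 else 3)
     else if J <ᵇ 5 then (if even then 5 else 4)
     else if even then 7 else 6) ≡ tBlock J even ((J ≡ᵇ 2) ∧ z)
  tBlock-tests 0 _ _     _ = refl
  tBlock-tests 1 _ _     _ = refl
  tBlock-tests 2 _ true  _ = refl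
  tBlock-tests 2 _ false _ = refl
  tBlock-tests 3 _ _     _ = refl
  tBlock-tests 4 _ _     _ = refl
  tBlock-tests 5 _ _     _ = refl
  tBlock-tests (suc (suc (suc (suc (suc (suc _)))))) _ _ (s≤s (s≤s (s≤s (s≤s (s≤s (s≤s ()))))))

t-block : ∀ c J ρ → ρ < 2 * c → J < 6 →
          t c (suc (2 * c * J + ρ)) ≡ tBlock J (even? (suc (2 * c * J + ρ))) ((J ≡ᵇ 2) ∧ (ρ ≡ᵇ 0))
t-block c J ρ ρ< J<6
  rewrite ≤ᵇ-block {c} {J} {ρ} 1 ρ< | ≤ᵇ-block {c} {J} {ρ} 2 ρ< | ≡ᵇ-block {c} {J} {ρ} ρ<
        | ≤ᵇ-block {c} {J} {ρ} 3 ρ< | ≤ᵇ-block {c} {J} {ρ} 4 ρ< | ≤ᵇ-block {c} {J} {ρ} 5 ρ<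
  = tBlock-tests J _ (ρ ≡ᵇ 0) J<6

t<8 : ∀ c m → t c m < 8
t<8 c m =
  if< (m ≤ᵇ 2 * c) (if< (even? m) (lit 1) (lit 0))
  (if< (m ≤ᵇ 4 * c) (if< (even? m) (lit 3) (lit 2))
  (if< (m ≡ᵇ 4 * c + 1) (lit 1)
  (if< (m ≤ᵇ 6 * c) (if< (even? m) (lit 4) (lit 5))
  (if< (m ≤ᵇ 8 * c) (if< (even? m) (lit 2) (lit 3))
  (if< (m ≤ᵇ 10 * c) (if< (even? m) (lit 5) (lit 4))
  (if< (even? m) (lit 7) (lit 6)))))))
  where
    if< : ∀ b {x y} → x < 8 → y < 8 → (if b then x else y) < 8
    if< true  x<8 _   = x<8
    if< false _   y<8 = y<8
    lit : ∀ x {_ : T (x <ᵇ 8)} → x < 8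
    lit x {x<8} = <ᵇ⇒< x 8 x<8

s-period : ∀ c .{{_ : NonZero c}} q m → 1 ≤ m → m ≤ 12 * c → s c (12 * c * q + m) ≡ 8 * q + t c m
s-period (suc k) q (suc r) _ m≤ = cong₂ (λ q′ m′ → 8 * q′ + t (suc k) m′) quotient residue
  where
    P = 12 * suc k
    pred≡ : P * q + suc r ∸ 1 ≡ q * P + r
    pred≡ = trans (cong (_∸ 1) (+-suc (P * q) r)) (cong (_+ r) (*-comm P q))
    quotient : (P * q + suc r ∸ 1) / P ≡ q
    quotient = trans (cong (_/ P) pred≡) ([q*d+r]/d≡q q r P m≤)
    residue : P * q + suc r ∸ P * ((P * q + suc r ∸ 1) / P) ≡ suc r
    residue = trans (cong (λ q′ → P * q + suc r ∸ P * q′) quotient) (m+n∸m≡n (P * q) (suc r))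

module _ (c : ℕ) .{{_ : NonZero c}} where

  private instance
    2c≢0  = m*n≢0 2 c
    12c≢0 = m*n≢0 12 c

  periodOf residueOf : ℕ → ℕ
  periodOf  n = (n ∸ 1) / (12 * c)
  residueOf n = suc ((n ∸ 1) % (12 * c))

  n≡period+residue : ∀ n → 1 ≤ n → n ≡ 12 * c * periodOf n + residueOf n
  n≡period+residue (suc n) _ = 1+m≡d*[m/d]+1+[m%d] n (12 * c)

  residueOf≤12c : ∀ n → residueOf n ≤ 12 * c
  residueOf≤12c n = m%n<n (n ∸ 1) (12 * c)

  residueOf-period : ∀ q m → 1 ≤ m → m ≤ 12 * c → residueOf (12 * c * q + m) ≡ m
  residueOf-period q (suc r) _ m≤ = cong suc (trans (cong (λ x → (x ∸ 1) % (12 * c)) (+-suc (12 * c * q) r))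
    (trans (cong (λ x → (x + r) % (12 * c)) (*-comm (12 * c) q)) ([q*d+r]%d≡r q r (12 * c) m≤)))

  s≡period+t : ∀ n → 1 ≤ n → s c n ≡ 8 * periodOf n + t c (residueOf n)
  s≡period+t n 1≤n = trans (cong (s c) (n≡period+residue n 1≤n))
    (s-period c (periodOf n) (residueOf n) (s≤s z≤n) (residueOf≤12c n))

  blockOf offsetOf : ℕ → ℕ
  blockOf  m = (m ∸ 1) / (2 * c)
  offsetOf m = (m ∸ 1) % (2 * c)

  m≡block+offset : ∀ m → 1 ≤ m → m ≡ suc (2 * c * blockOf m + offsetOf m)
  m≡block+offset (suc m) _ = trans (1+m≡d*[m/d]+1+[m%d] m (2 * c)) (+-suc _ _)

  offsetOf<2c : ∀ m → offsetOf m < 2 * c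
  offsetOf<2c m = m%n<n (m ∸ 1) (2 * c)

  blockOf<6 : ∀ m → m ≤ 12 * c → blockOf m < 6
  blockOf<6 zero    _  = subst (_< 6) (sym (0/n≡0 (2 * c))) (s≤s z≤n)
  blockOf<6 (suc m) m≤ = m<n*o⇒m/o<n {m} {6} {2 * c} (subst (m <_) (12c≡ c) m≤)
    where
      12c≡ : ∀ c → 12 * c ≡ 6 * (2 * c)
      12c≡ = solve-∀

  isSpecial : ℕ → Bool
  isSpecial m = (blockOf m ≡ᵇ 2) ∧ (offsetOf m ≡ᵇ 0)

  t≡tBlock : ∀ m → 1 ≤ m → m ≤ 12 * c → t c m ≡ tBlock (blockOf m) (not (isOdd m)) (isSpecial m)
  t≡tBlock m 1≤m m≤ = subst (λ x → t c x ≡ tBlock (blockOf m) (not (isOdd x)) (isSpecial m)) (sym (m≡block+offset m 1≤m))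
    (trans (t-block c (blockOf m) (offsetOf m) (offsetOf<2c m) (blockOf<6 m m≤))
           (cong (λ e → tBlock (blockOf m) e (isSpecial m)) (even?≡not-isOdd (suc (2 * c * blockOf m + offsetOf m)))))

allBelow : ℕ → (ℕ → Bool) → Bool
allBelow zero    p = true
allBelow (suc n) p = allBelow n p ∧ p n

allBelow-sound : ∀ n p → T (allBelow n p) → ∀ x → x < n → T (p x)
allBelow-sound (suc n) p all x x<1+n with Equivalence.to T-∧ all | m≤n⇒m<n∨m≡n (≤-pred x<1+n)
... | below , _  | inj₁ x<n  = allBelow-sound n p below x x<n
... | _     , px | inj₂ refl = px

allBool : (Bool → Bool) → Bool
allBool p = p false ∧ p true

allBool-sound : ∀ p → T (allBool p) → ∀ b → T (p b)
allBool-sound p all false = proj₁ (Equivalence.to T-∧ all)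
allBool-sound p all true  = proj₂ (Equivalence.to T-∧ all)

allBelow² : ℕ → (ℕ → Bool → Bool → Bool) → Bool
allBelow² n p = allBelow n λ x → allBool λ a → allBool (p x a)

allBelow²-sound : ∀ n p → T (allBelow² n p) → ∀ x a b → x < n → T (p x a b)
allBelow²-sound n p all x a b x<n =
  allBool-sound (p x a) (allBool-sound (λ a → allBool (p x a))
    (allBelow-sound n (λ x → allBool λ a → allBool (p x a)) all x x<n) a) b

-- A residue lies in block J of parity `odd`; `special` marks 4c + 1, which lies in block 2 and is odd.
admissible : ℕ → Bool → Bool → Bool
admissible J odd special = special ⇒ᵇ (J ≡ᵇ 2) ∧ odd

-- Scanning residues m₁, m₂, … one at a time, the state records min 6 (blocks so far), the nim-sum v of
-- their t-values, and the parities of their sum and of their number.  Bit 1 of t(m) is the parity of the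
-- block of m, bit 0 is not (isOdd m) xor [block ∈ {2,3}], and bit 2 is [block ∈ {2,4,5}] (except at 4c + 1);
-- the invariant records what these facts imply about the bits of v while the block total is small.
Invariant : ℕ → ℕ → Bool → Bool → Bool
Invariant I v sumOdd countOdd =
  ((I ≡ᵇ 6) ∨ not (isOdd (v / 2) xor isOdd I)) ∧
  (if I ≤ᵇ 1 then not r ∧ not bit2 else if I ≤ᵇ 3 then r ∨ not bit2 else true)
  where
    r    = isOdd v xor sumOdd xor countOdd
    bit2 = isOdd (v / 4)

closureStep : ℕ → ℕ → Bool → Bool → ℕ → Bool → Bool → Bool
closureStep I v P K J odd special =
  admissible J odd special ⇒ᵇ Invariant (6 ⊓ (J + I)) (tBlock J (not odd) special ⊕ v) (odd xor P) (not K)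

closureFrom : ℕ → ℕ → Bool → Bool → Bool
closureFrom I v P K = Invariant I v P K ⇒ᵇ allBelow² 6 (closureStep I v P K)

closureTest : Bool
closureTest = allBelow 7 λ I → allBelow² 8 (closureFrom I)

finalStep : ℕ → ℕ → Bool → ℕ → Bool → Bool
finalStep I v P J special = (suc I ≤ᵇ J) ⇒ᵇ admissible J P special ⇒ᵇ not (tBlock J (not P) special ≡ᵇ v)

finalFrom : ℕ → ℕ → Bool → Bool
finalFrom I v P = Invariant I v P true ⇒ᵇ allBelow 6 λ J → allBool (finalStep I v P J)

finalTest : Bool
finalTest = allBelow 7 λ I → allBelow 8 λ v → allBool (finalFrom I v)

pairStep : ℕ → Bool → Bool → ℕ → Bool → Bool → ℕ → Bool → Bool
pairStep J₁ odd₁ special₁ J₂ odd₂ special₂ J special =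
  admissible J (odd₁ xor odd₂) special ⇒ᵇ ((J ≡ᵇ J₁ + J₂) ∧ not special) ∨ (J ≡ᵇ suc (J₁ + J₂)) ⇒ᵇ
  not (tBlock J (not (odd₁ xor odd₂)) special ≡ᵇ tBlock J₁ (not odd₁) special₁ ⊕ tBlock J₂ (not odd₂) special₂)

pairFrom : ℕ → Bool → Bool → ℕ → Bool → Bool → Bool
pairFrom J₁ odd₁ special₁ J₂ odd₂ special₂ =
  admissible J₁ odd₁ special₁ ⇒ᵇ admissible J₂ odd₂ special₂ ⇒ᵇ
  allBelow 6 λ J → allBool (pairStep J₁ odd₁ special₁ J₂ odd₂ special₂ J)

pairTest : Bool
pairTest = allBelow² 6 λ J₁ odd₁ special₁ → allBelow² 6 (pairFrom J₁ odd₁ special₁)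

closureTest-holds : T closureTest
closureTest-holds = _

finalTest-holds : T finalTest
finalTest-holds = _

pairTest-holds : T pairTest
pairTest-holds = _

closureTest-sound : ∀ {I v P K J odd special} → I < 7 → v < 8 → J < 6 →
                    T (Invariant I v P K) → T (admissible J odd special) →
                    T (Invariant (6 ⊓ (J + I)) (tBlock J (not odd) special ⊕ v) (odd xor P) (not K))
closureTest-sound {I} {v} {P} {K} {J} {odd} {special} I<7 v<8 J<6 inv adm =
  ⇒ᵇ-elim (allBelow²-sound 6 (closureStep I v P K) (⇒ᵇ-elim from inv) J odd special J<6) adm
  where
    from : T (closureFrom I v P K)
    from = allBelow²-sound 8 (closureFrom I)
      (allBelow-sound 7 (λ I → allBelow² 8 (closureFrom I)) closureTest-holds I I<7) v P K v<8

finalTest-sound : ∀ {I v P J special} → I < 7 → v < 8 → J < 6 →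
                  T (Invariant I v P true) → I < J → T (admissible J P special) →
                  tBlock J (not P) special ≢ v
finalTest-sound {I} {v} {P} {J} {special} I<7 v<8 J<6 inv I<J adm eq = T-not-elim
  (⇒ᵇ-elim (⇒ᵇ-elim (allBool-sound (finalStep I v P J)
                       (allBelow-sound 6 (λ J → allBool (finalStep I v P J)) (⇒ᵇ-elim from inv) J J<6) special)
    (≤⇒≤ᵇ I<J)) adm)
  (≡⇒≡ᵇ _ _ eq)
  where
    from : T (finalFrom I v P)
    from = allBool-sound (finalFrom I v) (allBelow-sound 8 (λ v → allBool (finalFrom I v))
      (allBelow-sound 7 (λ I → allBelow 8 λ v → allBool (finalFrom I v)) finalTest-holds I I<7) v v<8) P

pairTest-sound : ∀ {J₁ odd₁ special₁ J₂ odd₂ special₂ J special} → J₁ < 6 → J₂ < 6 → J < 6 →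
                 T (admissible J₁ odd₁ special₁) → T (admissible J₂ odd₂ special₂) →
                 T (admissible J (odd₁ xor odd₂) special) →
                 T (((J ≡ᵇ J₁ + J₂) ∧ not special) ∨ (J ≡ᵇ suc (J₁ + J₂))) →
                 tBlock J (not (odd₁ xor odd₂)) special ≢ tBlock J₁ (not odd₁) special₁ ⊕ tBlock J₂ (not odd₂) special₂
pairTest-sound {J₁} {odd₁} {special₁} {J₂} {odd₂} {special₂} {J} {special} J₁<6 J₂<6 J<6 adm₁ adm₂ adm carry eq =
  T-not-elim (⇒ᵇ-elim (⇒ᵇ-elim step adm) carry) (≡⇒≡ᵇ _ _ eq)
  where
    from : T (pairFrom J₁ odd₁ special₁ J₂ odd₂ special₂)
    from = allBelow²-sound 6 (pairFrom J₁ odd₁ special₁)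
      (allBelow²-sound 6 (λ J₁ odd₁ special₁ → allBelow² 6 (pairFrom J₁ odd₁ special₁)) pairTest-holds J₁ odd₁ special₁ J₁<6)
      J₂ odd₂ special₂ J₂<6
    step : T (pairStep J₁ odd₁ special₁ J₂ odd₂ special₂ J special)
    step = allBool-sound (pairStep J₁ odd₁ special₁ J₂ odd₂ special₂ J)
      (allBelow-sound 6 (λ J → allBool (pairStep J₁ odd₁ special₁ J₂ odd₂ special₂ J)) (⇒ᵇ-elim (⇒ᵇ-elim from adm₁) adm₂) J J<6)
      special

⊓-absorb-+ : ∀ a J X → a ⊓ (J + a ⊓ X) ≡ a ⊓ (J + X)
⊓-absorb-+ a J X with ≤-total X a
... | inj₁ X≤a = cong (λ y → a ⊓ (J + y)) (m≥n⇒m⊓n≡n X≤a)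
... | inj₂ a≤X = trans (cong (λ y → a ⊓ (J + y)) (m≤n⇒m⊓n≡m a≤X))
                       (trans (m≤n⇒m⊓n≡m (m≤n+m a J)) (sym (m≤n⇒m⊓n≡m (≤-trans a≤X (m≤n+m X J)))))

module _ (c : ℕ) .{{_ : NonZero c}} where

  private instance
    2c≢0 = m*n≢0 2 c

  admissible-residue : ∀ m → 1 ≤ m → T (admissible (blockOf c m) (isOdd m) (isSpecial c m))
  admissible-residue m 1≤m with blockOf c m ≡ᵇ 2 in J≡ᵇ2 | offsetOf c m ≡ᵇ 0 in ρ≡ᵇ0
  ... | false | _     = _
  ... | true  | false = _
  ... | true  | true  = subst (λ x → T (isOdd x)) (sym m≡4c+1) odd-4c+1
    where
      m≡4c+1 : m ≡ suc (2 * c * 2 + 0)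
      m≡4c+1 = trans (m≡block+offset c m 1≤m)
        (cong₂ (λ J ρ → suc (2 * c * J + ρ)) (≡ᵇ⇒≡ _ 2 (subst T (sym J≡ᵇ2) _)) (≡ᵇ⇒≡ _ 0 (subst T (sym ρ≡ᵇ0) _)))
      odd-4c+1 : T (isOdd (suc (2 * c * 2 + 0)))
      odd-4c+1 = subst (λ b → T (not b)) (sym (trans (cong isOdd (trans (+-identityʳ _) (*-comm (2 * c) 2))) (isOdd-2* (2 * c)))) _

  nimSum-t<8 : ∀ ms → nimSumOf (t c) ms < 8
  nimSum-t<8 []       = s≤s z≤n
  nimSum-t<8 (m ∷ ms) = ⊕-<-2^ 3 (t c m) (nimSumOf (t c) ms) (t<8 c m) (nimSum-t<8 ms)

  blockSum : List ℕ → ℕ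
  blockSum ms = sum (map (blockOf c) ms)

  Invariant-holds : ∀ ms → All (1 ≤_) ms → sum ms ≤ 12 * c →
         T (Invariant (6 ⊓ blockSum ms) (nimSumOf (t c) ms) (isOdd (sum ms)) (isOdd (length ms)))
  Invariant-holds []       []          _  = _
  Invariant-holds (m ∷ ms) (1≤m ∷ pos) le =
    subst₂ (λ I P → T (Invariant I (nimSumOf (t c) (m ∷ ms)) P (isOdd (length (m ∷ ms)))))
      (⊓-absorb-+ 6 (blockOf c m) (blockSum ms)) (sym (isOdd-+ m (sum ms)))
      (subst (λ v → T (Invariant (6 ⊓ (blockOf c m + 6 ⊓ blockSum ms)) (v ⊕ nimSumOf (t c) ms)
                                 (isOdd m xor isOdd (sum ms)) (isOdd (length (m ∷ ms)))))
              (sym (t≡tBlock c m 1≤m m≤12c))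
        (closureTest-sound (s≤s (m⊓n≤m 6 _)) (nimSum-t<8 ms) (blockOf<6 c m m≤12c)
                 (Invariant-holds ms pos (≤-trans (m≤n+m (sum ms) m) le)) (admissible-residue m 1≤m)))
    where
      m≤12c : m ≤ 12 * c
      m≤12c = ≤-trans (m≤m+n m (sum ms)) le

  length+blocks≤sum : ∀ ms → All (1 ≤_) ms → length ms + 2 * c * blockSum ms ≤ sum ms
  length+blocks≤sum []       []          = ≤-reflexive (*-zeroʳ (2 * c))
  length+blocks≤sum (m ∷ ms) (1≤m ∷ pos) = begin
    suc (length ms) + 2 * c * (blockOf c m + blockSum ms)
      ≡⟨ regroup (length ms) (2 * c) (blockOf c m) (blockSum ms) ⟩
    suc (2 * c * blockOf c m) + (length ms + 2 * c * blockSum ms)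
      ≤⟨ +-mono-≤ (s≤s (m≤m+n _ (offsetOf c m))) (length+blocks≤sum ms pos) ⟩
    suc (2 * c * blockOf c m + offsetOf c m) + sum ms
      ≡⟨ cong (_+ sum ms) (sym (m≡block+offset c m 1≤m)) ⟩
    m + sum ms ∎
    where
      open ≤-Reasoning
      regroup : ∀ L d J B → suc L + d * (J + B) ≡ suc (d * J) + (L + d * B)
      regroup = solve-∀

  -- The 2c + 1 residues push the block of their sum beyond the total of their blocks.
  residues-2c+1 : ∀ ms → All (1 ≤_) ms → length ms ≡ suc (2 * c) → sum ms ≤ 12 * c → nimSumOf (t c) ms ≢ t c (sum ms)
  residues-2c+1 ms pos len M≤12c eq =
    finalTest-sound (s≤s (m⊓n≤m 6 B)) (nimSum-t<8 ms) (blockOf<6 c M M≤12c) inv (≤-<-trans (m⊓n≤n 6 B) B<J)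
          (admissible-residue M 1≤M) (trans (sym (t≡tBlock c M 1≤M M≤12c)) (sym eq))
    where
      M = sum ms
      B = blockSum ms
      1≤M : 1 ≤ M
      1≤M = ≤-trans (subst (1 ≤_) (sym len) (s≤s z≤n)) (length≤sum pos)
      odd-length : isOdd (length ms) ≡ true
      odd-length = trans (cong isOdd len) (cong not (isOdd-2* c))
      inv : T (Invariant (6 ⊓ B) (nimSumOf (t c) ms) (isOdd M) true)
      inv = subst (λ K → T (Invariant (6 ⊓ B) (nimSumOf (t c) ms) (isOdd M) K)) odd-length (Invariant-holds ms pos M≤12c)
      B<J : B < blockOf c M
      B<J = block-≤⁻ (offsetOf<2c c M) (≤-pred (begin
        suc (2 * c * suc B)                               ≡⟨ cong suc (*-suc (2 * c) B) ⟩
        suc (2 * c) + 2 * c * B                           ≡⟨ cong (_+ 2 * c * B) (sym len) ⟩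
        length ms + 2 * c * B                             ≤⟨ length+blocks≤sum ms pos ⟩
        M                                                 ≡⟨ m≡block+offset c M 1≤M ⟩
        suc (2 * c * blockOf c M + offsetOf c M)          ∎))
        where open ≤-Reasoning

  private
    carry-holds : ∀ {J ρ X R} → (J ≡ X × ρ ≡ suc R) ⊎ J ≡ suc X →
                  T (((J ≡ᵇ X) ∧ not ((J ≡ᵇ 2) ∧ (ρ ≡ᵇ 0))) ∨ (J ≡ᵇ suc X))
    carry-holds {X = X} (inj₁ (refl , refl)) rewrite ≡ᵇ-refl X | ∧-zeroʳ (X ≡ᵇ 2) = _
    carry-holds {X = X} (inj₂ refl) rewrite ≡ᵇ-refl X = subst T (sym (∨-zeroʳ _)) _

  -- The block of m₁ + m₂ is J₁ + J₂ (and then m₁ + m₂ ≠ 4c + 1) or J₁ + J₂ + 1.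
  residues-2 : ∀ m₁ m₂ → 1 ≤ m₁ → 1 ≤ m₂ → m₁ + m₂ ≤ 12 * c → t c m₁ ⊕ t c m₂ ≢ t c (m₁ + m₂)
  residues-2 m₁ m₂ 1≤m₁ 1≤m₂ M≤12c eq =
    pairTest-sound (blockOf<6 c m₁ m₁≤12c) (blockOf<6 c m₂ m₂≤12c) (blockOf<6 c M M≤12c)
         (admissible-residue m₁ 1≤m₁) (admissible-residue m₂ 1≤m₂)
         (subst (λ o → T (admissible (blockOf c M) o (isSpecial c M))) (isOdd-+ m₁ m₂) (admissible-residue M 1≤M))
         (carry-holds (block-carry (offsetOf<2c c M) R<4c blocks))
         (begin
           tBlock (blockOf c M) (not (isOdd m₁ xor isOdd m₂)) (isSpecial c M)
             ≡⟨ cong (λ o → tBlock (blockOf c M) (not o) (isSpecial c M)) (sym (isOdd-+ m₁ m₂)) ⟩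
           tBlock (blockOf c M) (not (isOdd M)) (isSpecial c M)
             ≡⟨ sym (t≡tBlock c M 1≤M M≤12c) ⟩
           t c M
             ≡⟨ sym eq ⟩
           t c m₁ ⊕ t c m₂
             ≡⟨ cong₂ _⊕_ (t≡tBlock c m₁ 1≤m₁ m₁≤12c) (t≡tBlock c m₂ 1≤m₂ m₂≤12c) ⟩
           tBlock (blockOf c m₁) (not (isOdd m₁)) (isSpecial c m₁) ⊕ tBlock (blockOf c m₂) (not (isOdd m₂)) (isSpecial c m₂)
             ∎)
    where
      open ≡-Reasoning
      M = m₁ + m₂
      1≤M : 1 ≤ M
      1≤M = ≤-trans 1≤m₁ (m≤m+n m₁ m₂)
      m₁≤12c : m₁ ≤ 12 * c
      m₁≤12c = ≤-trans (m≤m+n m₁ m₂) M≤12c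
      m₂≤12c : m₂ ≤ 12 * c
      m₂≤12c = ≤-trans (m≤n+m m₂ m₁) M≤12c
      ρ₁ = offsetOf c m₁
      ρ₂ = offsetOf c m₂
      R<4c : suc (ρ₁ + ρ₂) < 2 * c + 2 * c
      R<4c = subst (_≤ 2 * c + 2 * c) (+-suc (suc ρ₁) ρ₂) (+-mono-≤ (offsetOf<2c c m₁) (offsetOf<2c c m₂))
      blocks : 2 * c * blockOf c M + offsetOf c M ≡ 2 * c * (blockOf c m₁ + blockOf c m₂) + suc (ρ₁ + ρ₂)
      blocks = suc-injective (begin
        suc (2 * c * blockOf c M + offsetOf c M)   ≡⟨ sym (m≡block+offset c M 1≤M) ⟩
        m₁ + m₂                                    ≡⟨ cong₂ _+_ (m≡block+offset c m₁ 1≤m₁) (m≡block+offset c m₂ 1≤m₂) ⟩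
        suc (2 * c * blockOf c m₁ + ρ₁) + suc (2 * c * blockOf c m₂ + ρ₂)
                                                   ≡⟨ regroup (2 * c) (blockOf c m₁) ρ₁ (blockOf c m₂) ρ₂ ⟩
        suc (2 * c * (blockOf c m₁ + blockOf c m₂) + suc (ρ₁ + ρ₂)) ∎)
        where
          regroup : ∀ d J₁ ρ₁ J₂ ρ₂ → suc (d * J₁ + ρ₁) + suc (d * J₂ + ρ₂) ≡ suc (d * (J₁ + J₂) + suc (ρ₁ + ρ₂))
          regroup = solve-∀

-- No option has value s(N)

nimSumOf≤sum : ∀ f hs → nimSumOf f hs ≤ sum (map f hs)
nimSumOf≤sum f []       = z≤n
nimSumOf≤sum f (h ∷ hs) = ≤-trans (⊕≤+ (f h) (nimSumOf f hs)) (+-monoʳ-≤ (f h) (nimSumOf≤sum f hs))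

module _ (c : ℕ) .{{_ : NonZero c}} where

  private
    P = periodOf c
    R = residueOf c

    residues-pos : ∀ hs → All (1 ≤_) (map R hs)
    residues-pos []       = []
    residues-pos (h ∷ hs) = s≤s z≤n ∷ residues-pos hs

    nimSum-s : ∀ hs → All (1 ≤_) hs → nimSumOf (s c) hs ≡ 8 * nimSumOf P hs + nimSumOf (t c) (map R hs)
    nimSum-s []       []          = refl
    nimSum-s (h ∷ hs) (1≤h ∷ pos) = begin
      s c h ⊕ nimSumOf (s c) hs
        ≡⟨ cong₂ _⊕_ (s≡period+t c h 1≤h) (nimSum-s hs pos) ⟩
      (8 * P h + t c (R h)) ⊕ (8 * nimSumOf P hs + nimSumOf (t c) (map R hs))
        ≡⟨ ⊕-split 3 (P h) (nimSumOf P hs) (t c (R h)) _ (t<8 c (R h)) (nimSum-t<8 c (map R hs)) ⟩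
      8 * (P h ⊕ nimSumOf P hs) + (t c (R h) ⊕ nimSumOf (t c) (map R hs))
        ∎
      where open ≡-Reasoning

    sum-period+residue : ∀ hs → All (1 ≤_) hs → sum hs ≡ 12 * c * sum (map P hs) + sum (map R hs)
    sum-period+residue []       []          = sym (cong (_+ 0) (*-zeroʳ (12 * c)))
    sum-period+residue (h ∷ hs) (1≤h ∷ pos) =
      trans (cong₂ _+_ (n≡period+residue c h 1≤h) (sum-period+residue hs pos)) (regroup (12 * c) (P h) (R h) _ _)
      where
        regroup : ∀ d q m Q M → (d * q + m) + (d * Q + M) ≡ d * (q + Q) + (m + M)
        regroup = solve-∀

  -- The periods of the parts nim-add to the period of the whole; as nim-sum ≤ sum, no multiple of 12c can be
  -- carried, so the residues of the parts add up to the residue of the whole.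
  period-reduction : ∀ hs → All (1 ≤_) hs → 1 ≤ length hs → nimSumOf (s c) hs ≡ s c (sum hs) →
                     sum (map R hs) ≤ 12 * c × nimSumOf (t c) (map R hs) ≡ t c (sum (map R hs))
  period-reduction hs pos 1≤len eq = ΣR≤12c , trans low (cong (t c) R[N]≡ΣR)
    where
      N  = sum hs
      ΣP = sum (map P hs)
      ΣR = sum (map R hs)
      1≤N : 1 ≤ N
      1≤N = ≤-trans 1≤len (length≤sum pos)
      split = block-injective {8} (nimSum-t<8 c (map R hs)) (t<8 c (R N))
                (trans (sym (nimSum-s hs pos)) (trans eq (s≡period+t c N 1≤N)))
      high : nimSumOf P hs ≡ P N
      high = proj₁ split
      low : nimSumOf (t c) (map R hs) ≡ t c (R N)
      low = proj₂ split
      ΣR≤12c : ΣR ≤ 12 * c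
      ΣR≤12c = +-cancelˡ-≤ (12 * c * ΣP) ΣR (12 * c) (begin
        12 * c * ΣP + ΣR       ≡⟨ sym (sum-period+residue hs pos) ⟩
        N                      ≡⟨ n≡period+residue c N 1≤N ⟩
        12 * c * P N + R N     ≤⟨ +-mono-≤ (*-monoʳ-≤ (12 * c) (≤-trans (≤-reflexive (sym high)) (nimSumOf≤sum P hs)))
                                           (residueOf≤12c c N) ⟩
        12 * c * ΣP + 12 * c   ∎)
        where open ≤-Reasoning
      R[N]≡ΣR : R N ≡ ΣR
      R[N]≡ΣR = trans (cong R (sum-period+residue hs pos))
        (residueOf-period c ΣP ΣR (≤-trans (subst (1 ≤_) (sym (length-map R hs)) 1≤len) (length≤sum (residues-pos hs)))
                          ΣR≤12c)

  cutSet1-2c⁻ : ∀ {d} → cutSet1-2c c d ≡ true → d ≡ 1 ⊎ d ≡ 2 * c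
  cutSet1-2c⁻ {d} d∈C with d ≡ᵇ 1 in d≡ᵇ1 | d ≡ᵇ 2 * c in d≡ᵇ2c
  ... | true  | _    = inj₁ (≡ᵇ⇒≡ d 1 (subst T (sym d≡ᵇ1) _))
  ... | false | true = inj₂ (≡ᵇ⇒≡ d (2 * c) (subst T (sym d≡ᵇ2c) _))

  s∉options : ∀ N → 1 ≤ N → s c N ∉ options (cutSet1-2c c) (s c) N
  s∉options N 1≤N s∈
    with d , 1≤d , d∈C , hs , hs∈ , sN≡ ← ∈-options⁻ (cutSet1-2c c) (s c) N s∈
    with len , pos , total ← ∈-compositions⁻ (suc d) N hs∈
    with ΣR≤12c , residues≡ ← period-reduction hs pos (≤-trans (s≤s z≤n) (≤-reflexive (sym len)))
                                                     (trans (sym sN≡) (cong (s c) (sym total)))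
    with cutSet1-2c⁻ {d} d∈C
  ... | inj₂ refl = residues-2c+1 c (map R hs) (residues-pos hs) (trans (length-map R hs) len) ΣR≤12c residues≡
  ... | inj₁ refl with h₁ ∷ h₂ ∷ [] ← hs =
    residues-2 c (R h₁) (R h₂) (s≤s z≤n) (s≤s z≤n) (subst (_≤ 12 * c) (cong (R h₁ +_) (+-identityʳ (R h₂))) ΣR≤12c)
      (subst₂ (λ x y → x ≡ t c y) (cong (t c (R h₁) ⊕_) (⊕-identityʳ (t c (R h₂)))) (cong (R h₁ +_) (+-identityʳ (R h₂)))
              residues≡)

-- Every smaller value is an option

tAt : ℕ → ℕ → ℕ
tAt J ρ = tBlock J (isOdd ρ) ((J ≡ᵇ 2) ∧ (ρ ≡ᵇ 0))

-- Representative of the offsets ρ that no move shape below can tell apart: ρ itself if ρ ≤ 1, else 2 or 3 by parity.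
offsetClass : ℕ → ℕ
offsetClass 0             = 0
offsetClass 1             = 1
offsetClass (suc (suc ρ)) = if isOdd ρ then 3 else 2

offsetClass≤ : ∀ ρ → offsetClass ρ ≤ ρ
offsetClass≤ 0                   = z≤n
offsetClass≤ 1                   = s≤s z≤n
offsetClass≤ 2                   = ≤-refl
offsetClass≤ (suc (suc (suc ρ))) = ≤-trans (≤3 (not (isOdd ρ))) (s≤s (s≤s (s≤s z≤n)))
  where
    ≤3 : ∀ b → (if b then 3 else 2) ≤ 3
    ≤3 true  = ≤-refl
    ≤3 false = s≤s (s≤s z≤n)

offsetClass<4 : ∀ ρ → offsetClass ρ < 4
offsetClass<4 0             = s≤s z≤n
offsetClass<4 1             = s≤s (s≤s z≤n)
offsetClass<4 (suc (suc ρ)) with isOdd ρ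
... | true  = ≤-refl
... | false = s≤s (s≤s (s≤s z≤n))

isOdd-offsetClass : ∀ ρ → isOdd (offsetClass ρ) ≡ isOdd ρ
isOdd-offsetClass 0             = refl
isOdd-offsetClass 1             = refl
isOdd-offsetClass (suc (suc ρ)) with isOdd ρ
... | true  = refl
... | false = refl

tAt-offsetClass : ∀ J ρ → tAt J (offsetClass ρ) ≡ tAt J ρ
tAt-offsetClass J 0             = refl
tAt-offsetClass J 1             = refl
tAt-offsetClass J (suc (suc ρ)) with isOdd ρ
... | true  = refl
... | false = refl

tAt-offsetClass-pred : ∀ J ρ → 1 ≤ ρ → tAt J (offsetClass ρ ∸ 1) ≡ tAt J (ρ ∸ 1)
tAt-offsetClass-pred J 1             _ = refl
tAt-offsetClass-pred J (suc (suc ρ)) _ with isOdd ρ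
... | true  = refl
... | false = refl

-- Shapes of moves from N = 12cq + ⟨J,ρ⟩, where ⟨a,b⟩ = 2ca + b + 1 (`at a b` below).  `heap e a b` is the 2c-cut leaving
-- 12cq′ + ⟨a,b⟩ beside a cancelling pair and heaps of size 1, `twoHeaps e a b a′ b′` the one leaving 12cq′ + ⟨a,b⟩
-- and ⟨a′,b′⟩, with q′ = q, or q′ < q when e holds; a heap in an earlier period behaves like one six blocks further
-- down.  `splitOff A` is the 1-cut into ⟨A,0⟩ and 12cq + ⟨J − A, ρ − 1⟩, and `split2c` the one into 2c and
-- 12cq + ⟨J − 1, ρ⟩.
data Move : Set where
  heap      : (earlier : Bool) (a b : ℕ) → Move
  twoHeaps  : (earlier : Bool) (a b a′ b′ : ℕ) → Move
  splitOff  : (A : ℕ) → Move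
  split2c   : Move

isEarlier : Move → Bool
isEarlier (heap e _ _)         = e
isEarlier (twoHeaps e _ _ _ _) = e
isEarlier (splitOff _)         = false
isEarlier split2c              = false

reach : Bool → ℕ → ℕ
reach earlier J = if earlier then 6 + J else J

lexᵇ : ℕ → ℕ → ℕ → ℕ → Bool
lexᵇ A B J ρ = (A <ᵇ J) ∨ ((A ≡ᵇ J) ∧ (B ≤ᵇ ρ))

lex-≤ : ∀ {d A B J ρ̂ ρ} → B < d → ρ̂ ≤ ρ → T (lexᵇ A B J ρ̂) → d * A + B ≤ d * J + ρ
lex-≤ {d} {A} {B} {J} {ρ̂} {ρ} B<d ρ̂≤ρ lex with Equivalence.to T-∨ lex
... | inj₁ A<J = ≤-trans (<⇒≤ (block-< B<d (<ᵇ⇒< A J A<J))) (m≤m+n (d * J) ρ)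
... | inj₂ A≡J,B≤ρ̂ with Equivalence.to T-∧ A≡J,B≤ρ̂
...   | A≡J , B≤ρ̂ rewrite ≡ᵇ⇒≡ A J A≡J = +-monoʳ-≤ (d * J) (≤-trans (≤ᵇ⇒≤ B ρ̂ B≤ρ̂) ρ̂≤ρ)

applicable : ℕ → ℕ → Move → Bool
applicable J ρ (heap e a b)           = (a <ᵇ 6) ∧ (b <ᵇ 4) ∧ lexᵇ (suc a) b (reach e J) ρ ∧ not (isOdd b xor isOdd ρ)
applicable J ρ (twoHeaps e a b a′ b′) = (a <ᵇ 6) ∧ (a′ <ᵇ 6) ∧ (b + b′ <ᵇ 4) ∧ lexᵇ (a + a′ + 1) (b + b′) (reach e J) ρ
                                        ∧ not (isOdd b xor isOdd b′ xor isOdd ρ)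
applicable J ρ (splitOff A)           = (A ≤ᵇ J) ∧ (A <ᵇ 6) ∧ (1 ≤ᵇ ρ)
applicable J ρ split2c                = 1 ≤ᵇ J

moveValue : ℕ → ℕ → Move → ℕ
moveValue J ρ (heap _ a b)           = tAt a b
moveValue J ρ (twoHeaps _ a b a′ b′) = tAt a b ⊕ tAt a′ b′
moveValue J ρ (splitOff A)           = tAt A 0 ⊕ tAt (J ∸ A) (ρ ∸ 1)
moveValue J ρ split2c                = 1 ⊕ tAt (J ∸ 1) ρ

candidates : List Move
candidates =
  concatMap (λ e → concatMap (λ a → map (heap e a) (upTo 3)) (upTo 6)) (false ∷ true ∷ []) ++
  concatMap (λ e → concatMap (λ a → concatMap (λ b → concatMap (λ a′ → map (twoHeaps e a b a′) (upTo 2))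
                                                                (upTo 2)) (upTo 3)) (upTo 5)) (false ∷ true ∷ []) ++
  splitOff 0 ∷ splitOff 1 ∷ split2c ∷ []

realises : Bool → ℕ → ℕ → ℕ → Move → Bool
realises e J ρ r mv = not (isEarlier mv xor e) ∧ applicable J ρ mv ∧ (moveValue J ρ mv ≡ᵇ r)

realisableAt : ℕ → ℕ → ℕ → Bool
realisableAt J ρ r = ((r <ᵇ tAt J ρ) ⇒ᵇ any (realises false J ρ r) candidates) ∧ any (realises true J ρ r) candidates

realisableTest : Bool
realisableTest = allBelow 6 λ J → allBelow 4 λ ρ → allBelow 8 (realisableAt J ρ)

realisableTest-holds : T realisableTest
realisableTest-holds = _

module Lower (c : ℕ) (2≤c : 2 ≤ c) where

  private
    instance
      c≢0 = >-nonZero (≤-trans (s≤s z≤n) 2≤c)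
    C = cutSet1-2c c

  at : ℕ → ℕ → ℕ
  at J ρ = suc (2 * c * J + ρ)

  4≤2c : 4 ≤ 2 * c
  4≤2c = *-monoʳ-≤ 2 2≤c

  isOdd-at : ∀ J ρ → isOdd (at J ρ) ≡ not (isOdd ρ)
  isOdd-at J ρ = cong not (trans (cong (λ x → isOdd (x + ρ)) (*-assoc 2 c J)) (isOdd-2*+ (c * J) ρ))

  t-at : ∀ J ρ → ρ < 2 * c → J < 6 → t c (at J ρ) ≡ tAt J ρ
  t-at J ρ ρ< J<6 = trans (t-block c J ρ ρ< J<6)
    (cong (λ e → tBlock J e ((J ≡ᵇ 2) ∧ (ρ ≡ᵇ 0)))
          (trans (even?≡not-isOdd (at J ρ)) (trans (cong not (isOdd-at J ρ)) (not-involutive (isOdd ρ)))))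

  at≤12c : ∀ J ρ → ρ < 2 * c → J < 6 → at J ρ ≤ 12 * c
  at≤12c J ρ ρ< J<6 = subst (at J ρ ≤_) (12c≡ c) (block-< ρ< J<6)
    where
      12c≡ : ∀ c → 2 * c * 6 ≡ 12 * c
      12c≡ = solve-∀

  s-at : ∀ q J ρ → ρ < 2 * c → J < 6 → s c (12 * c * q + at J ρ) ≡ 8 * q + tAt J ρ
  s-at q J ρ ρ< J<6 = trans (s-period c q (at J ρ) (s≤s z≤n) (at≤12c J ρ ρ< J<6)) (cong (8 * q +_) (t-at J ρ ρ< J<6))

  s-at₀ : ∀ J ρ → ρ < 2 * c → J < 6 → s c (at J ρ) ≡ 8 * 0 + tAt J ρ
  s-at₀ J ρ ρ< J<6 = trans (cong (s c) (sym (cong (_+ at J ρ) (*-zeroʳ (12 * c))))) (s-at 0 J ρ ρ< J<6)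

  s1≡0 : s c 1 ≡ 0
  s1≡0 = trans (cong (s c) 1≡at00) (s-at₀ 0 0 (≤-trans (s≤s z≤n) 4≤2c) (s≤s z≤n))
    where
      1≡at00 : 1 ≡ at 0 0
      1≡at00 = cong suc (sym (trans (+-identityʳ (2 * c * 0)) (*-zeroʳ (2 * c))))

  s2c≡1 : s c (2 * c) ≡ 1
  s2c≡1 = trans (cong (s c) 2c≡at) (trans (s-at₀ 0 (pred (2 * c)) pred<2c (s≤s z≤n)) (cong (λ o → if o then 1 else 0) odd))
    where
      instance _ = m*n≢0 2 c
      pred<2c : pred (2 * c) < 2 * c
      pred<2c = subst (pred (2 * c) <_) (suc-pred (2 * c)) ≤-refl
      2c≡at : 2 * c ≡ at 0 (pred (2 * c))
      2c≡at = trans (sym (suc-pred (2 * c))) (cong suc (sym (cong (_+ pred (2 * c)) (*-zeroʳ (2 * c)))))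
      odd : isOdd (pred (2 * c)) ≡ true
      odd = trans (sym (not-involutive _)) (cong not (trans (cong isOdd (suc-pred (2 * c))) (isOdd-2* c)))

  private
    isOdd-period : ∀ q m → isOdd (12 * c * q + m) ≡ isOdd m
    isOdd-period q m = trans (cong (λ x → isOdd (x + m)) (twelve c q)) (isOdd-2*+ (6 * c * q) m)
      where
        twelve : ∀ c q → 12 * c * q ≡ 2 * (6 * c * q)
        twelve = solve-∀

    T-not-xor : ∀ {a b} → T (not (a xor b)) → a ≡ b
    T-not-xor {false} {false} _ = refl
    T-not-xor {true}  {true}  _ = refl

    T-not-xor₃ : ∀ {a b r} → T (not (a xor b xor r)) → not a xor not b ≡ r
    T-not-xor₃ {false} {false} {false} _ = refl
    T-not-xor₃ {false} {true}  {true}  _ = refl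
    T-not-xor₃ {true}  {false} {true}  _ = refl
    T-not-xor₃ {true}  {true}  {false} _ = refl

    tAt<8 : ∀ {J ρ} → ρ < 2 * c → J < 6 → tAt J ρ < 8
    tAt<8 {J} {ρ} ρ< J<6 = subst (_< 8) (t-at J ρ ρ< J<6) (t<8 c (at J ρ))

  Period : Bool → ℕ → ℕ → Set
  Period earlier q′ q = if earlier then q′ < q else q′ ≡ q

  module AtResidue (q J ρ : ℕ) (ρ<2c : ρ < 2 * c) (J<6 : J < 6) where

    N = 12 * c * q + at J ρ
    ρ̂ = offsetClass ρ

    private
      1≤period+at : ∀ q′ a b → 1 ≤ 12 * c * q′ + at a b
      1≤period+at q′ a b = ≤-trans (s≤s z≤n) (m≤n+m (at a b) (12 * c * q′))

      b<2c : ∀ {b} → b < 4 → b < 2 * c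
      b<2c b<4 = ≤-trans b<4 4≤2c

      reach-≤ : ∀ e {q′} → Period e q′ q → 12 * c * q′ + at (reach e J) ρ ≤ N
      reach-≤ false refl = ≤-refl
      reach-≤ true  {q′} q′<q = begin
        12 * c * q′ + at (6 + J) ρ     ≡⟨ shift c q′ J ρ ⟩
        12 * c * suc q′ + at J ρ       ≤⟨ +-monoˡ-≤ (at J ρ) (*-monoʳ-≤ (12 * c) q′<q) ⟩
        N                              ∎
        where
          open ≤-Reasoning
          shift : ∀ c q J ρ → 12 * c * q + suc (2 * c * (6 + J) + ρ) ≡ 12 * c * suc q + suc (2 * c * J + ρ)
          shift = solve-∀

    heap-sound : ∀ e {q′} a b → T (applicable J ρ̂ (heap e a b)) → Period e q′ q → 8 * q′ + tAt a b ∈ options C (s c) N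
    heap-sound e {q′} a b ok period
      with a<ᵇ6 , rest ← Equivalence.to T-∧ ok
      with b<ᵇ4 , rest ← Equivalence.to T-∧ rest
      with lex , parity ← Equivalence.to T-∧ rest =
      subst (_∈ options C (s c) N) (s-at q′ a b (b<2c b<4) a<6)
        (heap-option (s c) s1≡0 c {x = 12 * c * q′ + at a b} (≤-trans (s≤s z≤n) 2≤c) (1≤period+at q′ a b) x+2c≤N
          (trans (isOdd-period q′ (at a b)) (trans (isOdd-at a b)
            (trans (cong not (trans (T-not-xor parity) (isOdd-offsetClass ρ)))
                   (sym (trans (isOdd-period q (at J ρ)) (isOdd-at J ρ)))))))
      where
        a<6 : a < 6
        a<6 = <ᵇ⇒< a 6 a<ᵇ6
        b<4 : b < 4
        b<4 = <ᵇ⇒< b 4 b<ᵇ4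
        x+2c≤N : 12 * c * q′ + at a b + 2 * c ≤ N
        x+2c≤N = begin
          12 * c * q′ + at a b + 2 * c                ≡⟨ shift c q′ a b ⟩
          12 * c * q′ + suc (2 * c * suc a + b)       ≤⟨ +-monoʳ-≤ (12 * c * q′) (s≤s (lex-≤ (b<2c b<4) (offsetClass≤ ρ) lex)) ⟩
          12 * c * q′ + at (reach e J) ρ              ≤⟨ reach-≤ e period ⟩
          N                                           ∎
          where
            open ≤-Reasoning
            shift : ∀ c q a b → 12 * c * q + suc (2 * c * a + b) + 2 * c ≡ 12 * c * q + suc (2 * c * suc a + b)
            shift = solve-∀

    twoHeaps-sound : ∀ e {q′} a b a′ b′ → T (applicable J ρ̂ (twoHeaps e a b a′ b′)) → Period e q′ q →
                     8 * q′ + (tAt a b ⊕ tAt a′ b′) ∈ options C (s c) N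
    twoHeaps-sound e {q′} a b a′ b′ ok period
      with a<ᵇ6 , rest ← Equivalence.to T-∧ ok
      with a′<ᵇ6 , rest ← Equivalence.to T-∧ rest
      with bb′<ᵇ4 , rest ← Equivalence.to T-∧ rest
      with lex , parity ← Equivalence.to T-∧ rest =
      subst (_∈ options C (s c) N) values
        (twoHeap-option (s c) s1≡0 c {x = 12 * c * q′ + at a b} {y = at a′ b′} 2≤c (1≤period+at q′ a b) (s≤s z≤n) x+y+2c≤1+N
          (trans (isOdd-+ (12 * c * q′ + at a b) (at a′ b′))
            (trans (cong₂ _xor_ (trans (isOdd-period q′ (at a b)) (isOdd-at a b)) (isOdd-at a′ b′))
              (trans (T-not-xor₃ {isOdd b} {isOdd b′} parity) (trans (isOdd-offsetClass ρ)
                (sym (trans (cong not (trans (isOdd-period q (at J ρ)) (isOdd-at J ρ))) (not-involutive (isOdd ρ)))))))))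
      where
        bb′<4 : b + b′ < 4
        bb′<4 = <ᵇ⇒< (b + b′) 4 bb′<ᵇ4
        b<4 : b < 4
        b<4 = ≤-<-trans (m≤m+n b b′) bb′<4
        b′<4 : b′ < 4
        b′<4 = ≤-<-trans (m≤n+m b′ b) bb′<4
        values : s c (12 * c * q′ + at a b) ⊕ s c (at a′ b′) ≡ 8 * q′ + (tAt a b ⊕ tAt a′ b′)
        values = begin
          s c (12 * c * q′ + at a b) ⊕ s c (at a′ b′)
            ≡⟨ cong₂ _⊕_ (s-at q′ a b (b<2c b<4) (<ᵇ⇒< a 6 a<ᵇ6)) (s-at₀ a′ b′ (b<2c b′<4) (<ᵇ⇒< a′ 6 a′<ᵇ6)) ⟩
          (8 * q′ + tAt a b) ⊕ (8 * 0 + tAt a′ b′)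
            ≡⟨ ⊕-split 3 q′ 0 _ _ (tAt<8 (b<2c b<4) (<ᵇ⇒< a 6 a<ᵇ6)) (tAt<8 (b<2c b′<4) (<ᵇ⇒< a′ 6 a′<ᵇ6)) ⟩
          8 * (q′ ⊕ 0) + (tAt a b ⊕ tAt a′ b′)
            ≡⟨ cong (λ z → 8 * z + (tAt a b ⊕ tAt a′ b′)) (⊕-identityʳ q′) ⟩
          8 * q′ + (tAt a b ⊕ tAt a′ b′)
            ∎
          where open ≡-Reasoning
        x+y+2c≤1+N : 12 * c * q′ + at a b + at a′ b′ + 2 * c ≤ suc N
        x+y+2c≤1+N = begin
          12 * c * q′ + at a b + at a′ b′ + 2 * c                   ≡⟨ shift c q′ a b a′ b′ ⟩
          suc (12 * c * q′ + suc (2 * c * (a + a′ + 1) + (b + b′))) ≤⟨ s≤s (+-monoʳ-≤ (12 * c * q′)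
                                                                         (s≤s (lex-≤ (b<2c bb′<4) (offsetClass≤ ρ) lex))) ⟩
          suc (12 * c * q′ + at (reach e J) ρ)                      ≤⟨ s≤s (reach-≤ e period) ⟩
          suc N                                                     ∎
          where
            open ≤-Reasoning
            shift : ∀ c q a b a′ b′ → 12 * c * q + suc (2 * c * a + b) + suc (2 * c * a′ + b′) + 2 * c
                                      ≡ suc (12 * c * q + suc (2 * c * (a + a′ + 1) + (b + b′)))
            shift = solve-∀

    splitOff-sound : ∀ A → T (applicable J ρ̂ (splitOff A)) → 8 * q + moveValue J ρ̂ (splitOff A) ∈ options C (s c) N
    splitOff-sound A ok
      with A≤ᵇJ , rest ← Equivalence.to T-∧ ok
      with A<ᵇ6 , 1≤ᵇρ̂ ← Equivalence.to T-∧ rest =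
      subst (_∈ options C (s c) N) values
        (split-option (s c) s1≡0 c {a = at A 0} {b = 12 * c * q + at K ρ′} (s≤s z≤n) (1≤period+at q K ρ′) parts)
      where
        1≤ρ : 1 ≤ ρ
        1≤ρ = ≤-trans (≤ᵇ⇒≤ 1 ρ̂ 1≤ᵇρ̂) (offsetClass≤ ρ)
        ρ′ = ρ ∸ 1
        A≤J : A ≤ J
        A≤J = ≤ᵇ⇒≤ A J A≤ᵇJ
        A<6 : A < 6
        A<6 = <ᵇ⇒< A 6 A<ᵇ6
        K = J ∸ A
        K<6 : K < 6
        K<6 = ≤-<-trans (m∸n≤m J A) J<6
        ρ′<2c : ρ′ < 2 * c
        ρ′<2c = ≤-<-trans (m∸n≤m ρ 1) ρ<2c
        0<2c : 0 < 2 * c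
        0<2c = ≤-trans (s≤s z≤n) 4≤2c
        parts : at A 0 + (12 * c * q + at K ρ′) ≡ 12 * c * q + at J ρ
        parts = trans (regroup c q A K ρ′)
          (cong₂ (λ j r → 12 * c * q + at j r) (m+[n∸m]≡n A≤J) (trans (+-comm 1 ρ′) (m∸n+n≡m 1≤ρ)))
          where
            regroup : ∀ c q A K ρ → suc (2 * c * A + 0) + (12 * c * q + suc (2 * c * K + ρ))
                                     ≡ 12 * c * q + suc (2 * c * (A + K) + suc ρ)
            regroup = solve-∀
        values : s c (at A 0) ⊕ s c (12 * c * q + at K ρ′) ≡ 8 * q + moveValue J ρ̂ (splitOff A)
        values = begin
          s c (at A 0) ⊕ s c (12 * c * q + at K ρ′)
            ≡⟨ cong₂ _⊕_ (s-at₀ A 0 0<2c A<6) (s-at q K ρ′ ρ′<2c K<6) ⟩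
          (8 * 0 + tAt A 0) ⊕ (8 * q + tAt K ρ′)
            ≡⟨ ⊕-split 3 0 q _ _ (tAt<8 0<2c A<6) (tAt<8 ρ′<2c K<6) ⟩
          8 * (0 ⊕ q) + (tAt A 0 ⊕ tAt K ρ′)
            ≡⟨ cong₂ (λ x y → 8 * x + (tAt A 0 ⊕ y)) (⊕-identityˡ q) (sym (tAt-offsetClass-pred K ρ 1≤ρ)) ⟩
          8 * q + moveValue J ρ̂ (splitOff A)
            ∎
          where open ≡-Reasoning

    split2c-sound : T (applicable J ρ̂ split2c) → 8 * q + moveValue J ρ̂ split2c ∈ options C (s c) N
    split2c-sound 1≤ᵇJ =
      subst (_∈ options C (s c) N) values
        (split-option (s c) s1≡0 c {a = 2 * c} {b = 12 * c * q + at K ρ} (≤-trans (s≤s z≤n) 4≤2c) (1≤period+at q K ρ) parts)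
      where
        1≤J : 1 ≤ J
        1≤J = ≤ᵇ⇒≤ 1 J 1≤ᵇJ
        K = J ∸ 1
        K<6 : K < 6
        K<6 = ≤-<-trans (m∸n≤m J 1) J<6
        parts : 2 * c + (12 * c * q + at K ρ) ≡ 12 * c * q + at J ρ
        parts = trans (regroup c q K ρ) (cong (λ j → 12 * c * q + at j ρ) (m+[n∸m]≡n 1≤J))
          where
            regroup : ∀ c q K ρ → 2 * c + (12 * c * q + suc (2 * c * K + ρ)) ≡ 12 * c * q + suc (2 * c * (1 + K) + ρ)
            regroup = solve-∀
        values : s c (2 * c) ⊕ s c (12 * c * q + at K ρ) ≡ 8 * q + moveValue J ρ̂ split2c
        values = begin
          s c (2 * c) ⊕ s c (12 * c * q + at K ρ)
            ≡⟨ cong₂ _⊕_ s2c≡1 (s-at q K ρ ρ<2c K<6) ⟩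
          (8 * 0 + 1) ⊕ (8 * q + tAt K ρ)
            ≡⟨ ⊕-split 3 0 q 1 _ (s≤s (s≤s z≤n)) (tAt<8 ρ<2c K<6) ⟩
          8 * (0 ⊕ q) + (1 ⊕ tAt K ρ)
            ≡⟨ cong₂ (λ x y → 8 * x + (1 ⊕ y)) (⊕-identityˡ q) (sym (tAt-offsetClass K ρ)) ⟩
          8 * q + moveValue J ρ̂ split2c
            ∎
          where open ≡-Reasoning

    move-sound : ∀ mv {q′} → T (applicable J ρ̂ mv) → Period (isEarlier mv) q′ q → 8 * q′ + moveValue J ρ̂ mv ∈ options C (s c) N
    move-sound (heap e a b)           ok period = heap-sound e a b ok period
    move-sound (twoHeaps e a b a′ b′) ok period = twoHeaps-sound e a b a′ b′ ok period
    move-sound (splitOff A)           ok refl   = splitOff-sound A ok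
    move-sound split2c                ok refl   = split2c-sound ok

    private
      w≡ : ∀ w → w ≡ 8 * (w / 8) + w % 8
      w≡ w = trans (m≡m%n+[m/n]*n w 8) (trans (+-comm (w % 8) _) (cong (_+ w % 8) (*-comm (w / 8) 8)))

      realisableAt-holds : ∀ r → r < 8 → T (realisableAt J ρ̂ r)
      realisableAt-holds r r<8 = allBelow-sound 8 (realisableAt J ρ̂)
        (allBelow-sound 4 (λ ρ → allBelow 8 (realisableAt J ρ))
          (allBelow-sound 6 (λ J → allBelow 4 λ ρ → allBelow 8 (realisableAt J ρ)) realisableTest-holds J J<6)
          ρ̂ (offsetClass<4 ρ)) r r<8

      realised : ∀ e {q′ r} → T (any (realises e J ρ̂ r) candidates) → Period e q′ q → 8 * q′ + r ∈ options C (s c) N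
      realised e {q′} {r} found period
        with mv , ok ← satisfied (any⁻ (realises e J ρ̂ r) candidates found)
        with same-period , rest ← Equivalence.to T-∧ ok
        with mv-applicable , value≡ ← Equivalence.to T-∧ rest =
        subst (λ v → 8 * q′ + v ∈ options C (s c) N) (≡ᵇ⇒≡ (moveValue J ρ̂ mv) r value≡)
          (move-sound mv mv-applicable (subst (λ e′ → Period e′ q′ q) (sym (T-not-xor same-period)) period))

    below-s∈options : ∀ w → w < 8 * q + tAt J ρ → w ∈ options C (s c) N
    below-s∈options w w< with block-<-lex {8} {w / 8} (tAt<8 ρ<2c J<6) (subst (_< 8 * q + tAt J ρ) (w≡ w) w<)
    ... | inj₁ earlier =
      subst (_∈ options C (s c) N) (sym (w≡ w)) (realised true {r = w % 8} (proj₂ (Equivalence.to T-∧ test)) earlier)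
      where test = realisableAt-holds (w % 8) (m%n<n w 8)
    ... | inj₂ (same , r<) = subst (_∈ options C (s c) N) (sym (w≡ w))
      (realised false {r = w % 8} (⇒ᵇ-elim (proj₁ (Equivalence.to T-∧ test))
                                            (<⇒<ᵇ (subst (w % 8 <_) (sym (tAt-offsetClass J ρ)) r<))) same)
      where test = realisableAt-holds (w % 8) (m%n<n w 8)

  <s∈options : ∀ N w → 1 ≤ N → w < s c N → w ∈ options C (s c) N
  <s∈options N w 1≤N w<sN = subst (λ n → w ∈ options C (s c) n) (sym N≡)
    (AtResidue.below-s∈options q J ρ ρ<2c J<6 w (subst (w <_) (trans (cong (s c) N≡) (s-at q J ρ ρ<2c J<6)) w<sN))
    where
      q = periodOf c N
      m = residueOf c N
      J = blockOf c m
      ρ = offsetOf c m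
      ρ<2c : ρ < 2 * c
      ρ<2c = offsetOf<2c c m
      J<6 : J < 6
      J<6 = blockOf<6 c m (residueOf≤12c c N)
      N≡ : N ≡ 12 * c * q + at J ρ
      N≡ = trans (n≡period+residue c N 1≤N) (cong (12 * c * q +_) (m≡block+offset c m (s≤s z≤n)))

theorem1 : (c : ℕ) → 2 ≤ c → (n : ℕ) → 1 ≤ n → nimSeq (cutSet1-2c c) n ≡ s c n
theorem1 c 2≤c = nimSeq-characterisation (cutSet1-2c c) (s c) (s∉options c) (Lower.<s∈options c 2≤c)
  where instance _ = >-nonZero (≤-trans (s≤s z≤n) 2≤c)
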